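{- Let $\mathfrak{g}$ be of type $D_{n+1}^{(2)}$, let $1\le r<n$, $s\ge1$, and let $L$ be the multiplicity array with $L_s^{(r)}=1$ and all other entries $0$. For a dominant weight $\lambda$ of the classical subalgebra, $\mathrm{hwRC}(L;\lambda)$ is nonempty if and only if $\lambda$ is obtained by removing single boxes from the $r\times s$ rectangle (i.e. $\lambda$ is a partition contained in the $r\times s$ rectangle), and in that case $\mathrm{hwRC}(L;\lambda)$ consists of the single rigged configuration with $$\nu^{(a)}=\begin{cases}\overline\lambda^{[r-a]} & 1\le a<r,\\ \overline\lambda & r\le a\le n,\end{cases}$$ and all labels equal to $0$.
   Context: Dynkin labelling of $D_{n+1}^{(2)}$ as in Kac: chain $0,1,\dots,n$ with double bonds between $0,1$ and between $n-1,n$; $I_0=\{1,\dots,n\}$, classical subalgebra (type $B_n$) with fundamental weights $\overline\Lambda_a$ and simple roots $\widetilde\alpha_a=\alpha_a$. $c_i,c_i^\vee$ Kac and dual Kac labels, $(\alpha_i\mid\alpha_j)=\frac{c_i^\vee}{c_i}A_{ij}$, $t_i=\max(c_i/c_i^\vee,c_0^\vee)$, $t_i^\vee=\max(c_i^\vee/c_i,c_0)$, $\upsilon_a=1$ for all $a$. A dominant weight $\lambda=\sum k_i\overline\Lambda_i$ ($i<n$) is identified with the partition having $k_i$ columns of height $i$, rows $\lambda_1\ge\dots\ge\lambda_r$. $\overline\lambda=(s-\lambda_r,\dots,s-\lambda_1)$ is the complement in the $r\times s$ rectangle; $\mu^{[m]}$ is $\mu$ with its $m$ largest rows removed. Rigged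 configurations: $\nu=(\nu^{(a)})_{a\in I_0}$ partitions, $m_i^{(a)}$ = number of parts of $\nu^{(a)}$ equal to $i$; $(L,\lambda)$-configuration if $\sum im_i^{(a)}\widetilde\alpha_a=\sum iL_i^{(a)}\overline\Lambda_a-\lambda$. Vacancy numbers $p_i^{(a)}=\sum_j\min(i,j)L_j^{(a)}-\frac1{t_a^\vee}\sum_{(b,j)}(\widetilde\alpha_a\mid\widetilde\alpha_b)\min(t_b\upsilon_ai,t_a\upsilon_bj)m_j^{(b)}$. $\mathrm{hwRC}(L;\lambda)$: pairs $(\nu,J)$ with $\nu$ an $(L,\lambda)$-configuration, all $p_i^{(a)}\ge0$, and $J$ assigning to each part of length $i$ of $\nu^{(a)}$ an integer label in $[0,p_i^{(a)}]$. -}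

module Defs where

open import Data.Bool using (Bool; true; false; if_then_else_; _∧_; _∨_)
open import Data.Nat as ℕ using (ℕ; zero; suc; _≡ᵇ_; _∸_; _⊓_; _⊔_)
open import Data.Integer as ℤ using (ℤ; +_)
open import Data.Rational as ℚ using (ℚ; _/_; 0ℚ; 1/_)
open import Data.List using (List; []; _∷_; map; foldr; upTo; filter; drop; reverse; replicate)
open import Data.List.Relation.Binary.Pointwise using (Pointwise)
open import Data.List.Relation.Unary.All using (All)
open import Data.List.Membership.Propositional using (_∈_)
open import Data.Product using (_×_; _,_; proj₁; proj₂)
open import Relation.Nullary.Decidable using (does)
open import Relation.Binary.PropositionalEquality using (_≡_)

-- Type D_{n+1}^{(2)} data (Kac labelling), nodes 0,1,…,n, n ≥ 2.

c : ℕ → ℕ → ℕ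
c n i = 1

cv : ℕ → ℕ → ℕ
cv n i = if (i ≡ᵇ 0) ∨ (i ≡ᵇ n) then 1 else 2

cv-nz : ∀ n i → ℕ.NonZero (cv n i)
cv-nz n i with (i ≡ᵇ 0) ∨ (i ≡ᵇ n)
... | true  = _
... | false = _

-- Affine Cartan matrix A_{ij} (i,j ∈ {0,…,n}) of D_{n+1}^{(2)}:
-- diagram 0 <= 1 - 2 - … - (n-1) => n, with α_0, α_n short;
-- A_{01} = A_{n,n-1} = -2, A_{10} = A_{n-1,n} = -1.
cartan : ℕ → ℕ → ℕ → ℤ
cartan n i j =
  if i ≡ᵇ j then + 2
  else if (suc i ≡ᵇ j) ∨ (suc j ≡ᵇ i) then
    (if ((i ≡ᵇ 0) ∧ (j ≡ᵇ 1)) ∨ ((i ≡ᵇ n) ∧ (suc j ≡ᵇ n)) then ℤ.- (+ 2) else ℤ.- (+ 1))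
  else + 0

ip : ℕ → ℕ → ℕ → ℚ
ip n i j = ((+ cv n i) / c n i) ℚ.* (cartan n i j / 1)

t : ℕ → ℕ → ℚ
t n i = ((+ c n i) / cv n i) {{cv-nz n i}} ℚ.⊔ ((+ cv n 0) / 1)

tv : ℕ → ℕ → ℚ
tv n i = ((+ cv n i) / c n i) ℚ.⊔ ((+ c n 0) / 1)

tv-nz : ∀ n i → ℚ.NonZero (tv n i)
tv-nz n i with (i ≡ᵇ 0) ∨ (i ≡ᵇ n)
... | true  = _
... | false = _

υ : ℕ → ℕ → ℚ
υ n a = 1ℚ'
  where 1ℚ' = (+ 1) / 1

sumℚ : List ℚ → ℚ
sumℚ = foldr ℚ._+_ 0ℚ

sumℤ : List ℤ → ℤ
sumℤ = foldr ℤ._+_ (+ 0)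

sumℕ : List ℕ → ℕ
sumℕ = foldr ℕ._+_ 0

oneTo : ℕ → List ℕ
oneTo n = map suc (upTo n)

range : ℕ → ℕ → List ℕ
range m n = map (m ℕ.+_) (upTo (n ∸ m))

nat→ℚ : ℕ → ℚ
nat→ℚ m = (+ m) / 1

data Decreasing : List ℕ → Set where
  []  : Decreasing []
  [_] : ∀ x → Decreasing (x ∷ [])
  _∷_ : ∀ {x y ys} → y ℕ.≤ x → Decreasing (y ∷ ys) → Decreasing (x ∷ y ∷ ys)

IsPartition : List ℕ → Set
IsPartition μ = Decreasing μ × All (λ x → 1 ℕ.≤ x) μ

size : List ℕ → ℕ
size = sumℕ

-- Multiplicity arrays: L is a finite list of pairs (a , i); L_i^{(a)} is
-- the number of occurrences of (a , i) in the list.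

MultArray : Set
MultArray = List (ℕ × ℕ)

entriesAt : MultArray → ℕ → List ℕ
entriesAt L a = map proj₂ (filter (λ e → proj₁ e ℕ.≟ a) L)

Lmin : MultArray → ℕ → ℕ → ℕ
Lmin L a i = sumℕ (map (λ j → i ⊓ j) (entriesAt L a))

Lsize : MultArray → ℕ → ℕ
Lsize L a = sumℕ (entriesAt L a)

-- Configurations and vacancy numbers.
-- ν a is the partition ν^{(a)} (only a ∈ {1,…,n} matter).
-- A classical weight is given by its coordinates k_1,…,k_n in the basis
-- of fundamental weights Λ̄_1,…,Λ̄_n of B_n; the simple root α̃_a = α_a
-- has coordinates  α_a = Σ_b A_{ba} Λ̄_b.

-- ν is an (L,λ)-configuration, λ = Σ_b k_b Λ̄_b:
-- Σ_a |ν^{(a)}| α_a = Σ_a (Σ_i i L_i^{(a)}) Λ̄_a - λ, compared coordinatewise.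
IsConfig : ℕ → MultArray → (ℕ → ℕ) → (ℕ → List ℕ) → Set
IsConfig n L k ν =
  ∀ b → 1 ℕ.≤ b → b ℕ.≤ n →
    sumℤ (map (λ a → cartan n b a ℤ.* (+ size (ν a))) (oneTo n))
      ≡ (+ Lsize L b) ℤ.- (+ k b)

-- vacancy number p_i^{(a)}
--   = Σ_j min(i,j) L_j^{(a)}
--     - (1/t_a^∨) Σ_{b,j} (α_a|α_b) min(t_b υ_a i, t_a υ_b j) m_j^{(b)}
-- (the sum over j with multiplicities m_j^{(b)} is the sum over the parts j of ν^{(b)})
vac : ℕ → MultArray → (ℕ → List ℕ) → ℕ → ℕ → ℚ
vac n L ν a i =
  nat→ℚ (Lmin L a i) ℚ.-
    ((1/ tv n a) {{tv-nz n a}} ℚ.*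
      sumℚ (map (λ b → ip n a b ℚ.*
               sumℚ (map (λ j → (t n b ℚ.* υ n a ℚ.* nat→ℚ i) ℚ.⊓ (t n a ℚ.* υ n b ℚ.* nat→ℚ j))
                         (ν b)))
             (oneTo n)))

-- (ν , J) ∈ hwRC(L; λ), λ = Σ k_b Λ̄_b.  J a is the list of labels attached to the
-- parts of ν^{(a)} (position by position).
hwRC : ℕ → MultArray → (ℕ → ℕ) → (ℕ → List ℕ) → (ℕ → List ℕ) → Set
hwRC n L k ν J =
  (∀ a → 1 ℕ.≤ a → a ℕ.≤ n → IsPartition (ν a)) ×
  IsConfig n L k ν ×
  (∀ a i → 1 ℕ.≤ a → a ℕ.≤ n → 1 ℕ.≤ i → 0ℚ ℚ.≤ vac n L ν a i) ×
  (∀ a → 1 ℕ.≤ a → a ℕ.≤ n →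
     Pointwise (λ j label → nat→ℚ label ℚ.≤ vac n L ν a j) (ν a) (J a))

-- The partition attached to λ = Σ_{i<n} k_i Λ̄_i : k_i columns of height i.
-- Row j (1 ≤ j) has length λ_j = Σ_{j ≤ i < n} k_i.

row : ℕ → (ℕ → ℕ) → ℕ → ℕ
row n k j = sumℕ (map k (range j n))

InRect : ℕ → ℕ → ℕ → (ℕ → ℕ) → Set
InRect n r s k = row n k 1 ℕ.≤ s × row n k (suc r) ≡ 0

complement : ℕ → ℕ → ℕ → (ℕ → ℕ) → List ℕ
complement n r s k =
  filter (λ x → 1 ℕ.≤? x) (map (λ j → s ∸ row n k j) (reverse (oneTo r)))

removeLargest : ℕ → List ℕ → List ℕ
removeLargest m μ = drop m μ

νλ : ℕ → ℕ → ℕ → (ℕ → ℕ) → ℕ → List ℕ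
νλ n r s k a =
  if does (a ℕ.<? r) then removeLargest (r ∸ a) (complement n r s k)
  else complement n r s k

zeroLabels : List ℕ → List ℕ
zeroLabels μ = replicate (Data.List.length μ) 0
  where import Data.List

-- Write Q_i(μ) = Σ_j min(i, μ_j). The vacancy numbers are the integers
-- p_i^{(a)} = δ_{ar} min(i,s) − Σ_b A_{ab} Q_i(ν^{(b)}), so p ≥ 0 says that for each i the sequence
-- a ↦ Q_i(ν^{(a)}) (with ν^{(0)} = ∅) is convex on [0,r] and on [r,n], bends by at most min(i,s)
-- at r, and does not increase from n−1 to n. As Q_{i+1} − Q_i is the (i+1)-st column length,
-- induction on i shows that each column of ν^{(a)} is the corresponding column of μ = ν^{(r)}
-- shortened by r − a for a ≤ r, and equal to it for a ≥ r: ν^{(a)} = μ^{[r−a]}, and μ has at most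
-- r rows. On such a staircase the configuration equations telescope to μ_{r+1−a} + λ_a = s for
-- a ≤ r and k_a = 0 for a > r, i.e. λ lies in the r × s rectangle and μ = λ̄. Conversely, on the
-- staircase built from λ̄ one finds p_i^{(a)} = min(i,y) − min(i,x) with x ≤ y and x the largest
-- part of ν^{(a)}; it is nonnegative and vanishes on every part of ν^{(a)}, forcing all labels to 0.

module Submission where

open import Defs
open import Data.Nat using (ℕ; _≤_; _<_)
open import Data.List using (List; []; _∷_)
open import Data.Product using (_×_; _,_; ∃₂)
open import Relation.Binary.PropositionalEquality using (_≡_)

module IntegralVacancy where

  open import Data.Bool using (true; false; _∨_)
  open import Data.Nat as ℕ using (ℕ; zero; suc; _≡ᵇ_; _⊓_)
  import Data.Nat.Properties as ℕ
  open import Data.Integer as ℤ using (ℤ; +_; -[1+_])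
  import Data.Integer.Properties as ℤ
  open import Data.Rational as ℚ using (ℚ; _/_; mkℚ; 1/_)
  import Data.Rational.Properties as ℚ
  open import Data.Rational.Unnormalised as ℚᵘ using (*≡*)
  import Data.Rational.Unnormalised.Properties as ℚᵘ
  open import Data.Nat.Coprimality using (1-coprimeTo; sym)
  open import Data.List using (List; []; _∷_; map)
  open import Data.List.Properties using (map-cong)
  open import Function using (_∘_)
  open import Data.Sum using (inj₁; inj₂)
  open import Relation.Binary.PropositionalEquality hiding (sym)
  import Relation.Binary.PropositionalEquality as ≡
  open ≡-Reasoning

  ℤ→ℚ : ℤ → ℚ
  ℤ→ℚ z = z / 1

  fromℤ : ℤ → ℚ
  fromℤ z = mkℚ z 0 (sym (1-coprimeTo ℤ.∣ z ∣))

  ℤ→ℚ≡fromℤ : ∀ z → ℤ→ℚ z ≡ fromℤ z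
  ℤ→ℚ≡fromℤ (+ n)    = ℚ.normalize-coprime (sym (1-coprimeTo n))
  ℤ→ℚ≡fromℤ -[1+ n ] = cong ℚ.-_ (ℚ.normalize-coprime (sym (1-coprimeTo (suc n))))

  ℤ→ℚ-+ : ∀ a b → ℤ→ℚ (a ℤ.+ b) ≡ ℤ→ℚ a ℚ.+ ℤ→ℚ b
  ℤ→ℚ-+ a b rewrite ℤ→ℚ≡fromℤ (a ℤ.+ b) | ℤ→ℚ≡fromℤ a | ℤ→ℚ≡fromℤ b =
    ℚ.toℚᵘ-injective (ℚᵘ.≃-trans (*≡* eq) (ℚᵘ.≃-sym (ℚ.toℚᵘ-homo-+ (fromℤ a) (fromℤ b))))
    where
    eq : (a ℤ.+ b) ℤ.* + 1 ≡ (a ℤ.* + 1 ℤ.+ b ℤ.* + 1) ℤ.* + 1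
    eq rewrite ℤ.*-identityʳ a | ℤ.*-identityʳ b = refl

  ℤ→ℚ-* : ∀ a b → ℤ→ℚ (a ℤ.* b) ≡ ℤ→ℚ a ℚ.* ℤ→ℚ b
  ℤ→ℚ-* a b rewrite ℤ→ℚ≡fromℤ (a ℤ.* b) | ℤ→ℚ≡fromℤ a | ℤ→ℚ≡fromℤ b =
    ℚ.toℚᵘ-injective (ℚᵘ.≃-sym (ℚ.toℚᵘ-homo-* (fromℤ a) (fromℤ b)))

  ℤ→ℚ-neg : ∀ a → ℤ→ℚ (ℤ.- a) ≡ ℚ.- ℤ→ℚ a
  ℤ→ℚ-neg a rewrite ℤ→ℚ≡fromℤ (ℤ.- a) | ℤ→ℚ≡fromℤ a with a
  ... | + zero  = refl
  ... | + suc n = refl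
  ... | -[1+ n ] = refl

  ℤ→ℚ-minus : ∀ a b → ℤ→ℚ (a ℤ.- b) ≡ ℤ→ℚ a ℚ.- ℤ→ℚ b
  ℤ→ℚ-minus a b = trans (ℤ→ℚ-+ a (ℤ.- b)) (cong (ℤ→ℚ a ℚ.+_) (ℤ→ℚ-neg b))

  ℤ→ℚ-mono-≤ : ∀ {a b} → a ℤ.≤ b → ℤ→ℚ a ℚ.≤ ℤ→ℚ b
  ℤ→ℚ-mono-≤ {a} {b} a≤b rewrite ℤ→ℚ≡fromℤ a | ℤ→ℚ≡fromℤ b = ℚ.*≤* (ℤ.*-monoʳ-≤-nonNeg (+ 1) a≤b)

  ℤ→ℚ-cancel-≤ : ∀ {a b} → ℤ→ℚ a ℚ.≤ ℤ→ℚ b → a ℤ.≤ b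
  ℤ→ℚ-cancel-≤ {a} {b} p rewrite ℤ→ℚ≡fromℤ a | ℤ→ℚ≡fromℤ b with p
  ... | ℚ.*≤* q = subst₂ ℤ._≤_ (ℤ.*-identityʳ a) (ℤ.*-identityʳ b) q

  ℤ→ℚ-⊓ : ∀ i j → ℤ→ℚ (+ (i ⊓ j)) ≡ ℤ→ℚ (+ i) ℚ.⊓ ℤ→ℚ (+ j)
  ℤ→ℚ-⊓ i j with ℕ.≤-total i j
  ... | inj₁ i≤j = trans (cong (ℤ→ℚ ∘ +_) (ℕ.m≤n⇒m⊓n≡m i≤j)) (≡.sym (ℚ.p≤q⇒p⊓q≡p (ℤ→ℚ-mono-≤ (ℤ.+≤+ i≤j))))
  ... | inj₂ j≤i = trans (cong (ℤ→ℚ ∘ +_) (ℕ.m≥n⇒m⊓n≡n j≤i)) (≡.sym (ℚ.p≥q⇒p⊓q≡q (ℤ→ℚ-mono-≤ (ℤ.+≤+ j≤i))))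

  ℤ→ℚ-sum : ∀ {A : Set} (f : A → ℤ) xs → sumℚ (map (ℤ→ℚ ∘ f) xs) ≡ ℤ→ℚ (sumℤ (map f xs))
  ℤ→ℚ-sum f []       = refl
  ℤ→ℚ-sum f (x ∷ xs) =
    trans (cong (ℤ→ℚ (f x) ℚ.+_) (ℤ→ℚ-sum f xs)) (≡.sym (ℤ→ℚ-+ (f x) (sumℤ (map f xs))))

  sumℚ-*ˡ : ∀ {A : Set} p (f : A → ℚ) xs → sumℚ (map (λ x → p ℚ.* f x) xs) ≡ p ℚ.* sumℚ (map f xs)
  sumℚ-*ˡ p f []       = ≡.sym (ℚ.*-zeroʳ p)
  sumℚ-*ˡ p f (x ∷ xs) =
    trans (cong (p ℚ.* f x ℚ.+_) (sumℚ-*ˡ p f xs)) (≡.sym (ℚ.*-distribˡ-+ p (f x) (sumℚ (map f xs))))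

  t≡1 : ∀ n a → t n a ≡ ℚ.1ℚ
  t≡1 n a with (a ≡ᵇ 0) ∨ (a ≡ᵇ n)
  ... | true  = refl
  ... | false = refl

  tv≡cv : ∀ n a → tv n a ≡ ℤ→ℚ (+ cv n a)
  tv≡cv n a with (a ≡ᵇ 0) ∨ (a ≡ᵇ n)
  ... | true  = refl
  ... | false = refl

  Q : ℕ → List ℕ → ℕ
  Q i μ = sumℕ (map (i ⊓_) μ)

  cartanSum : ℕ → ℕ → (ℕ → ℤ) → ℤ
  cartanSum n a f = sumℤ (map (λ b → cartan n a b ℤ.* f b) (oneTo n))

  -- p_i^{(a)} as an integer: t_b = 1, and 1/t_a^∨ cancels the factor c_a^∨ of (α_a|α_b)
  vacancy : ℕ → MultArray → (ℕ → List ℕ) → ℕ → ℕ → ℤ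
  vacancy n L ν a i = + Lmin L a i ℤ.- cartanSum n a (λ b → + Q i (ν b))

  Q-as-sumℚ : ∀ i μ → sumℚ (map (λ j → nat→ℚ i ℚ.⊓ nat→ℚ j) μ) ≡ ℤ→ℚ (+ Q i μ)
  Q-as-sumℚ i []      = refl
  Q-as-sumℚ i (j ∷ μ) =
    trans (cong₂ ℚ._+_ (≡.sym (ℤ→ℚ-⊓ i j)) (Q-as-sumℚ i μ)) (≡.sym (ℤ→ℚ-+ (+ (i ⊓ j)) (+ Q i μ)))

  vac≡vacancy : ∀ n L ν a i → vac n L ν a i ≡ ℤ→ℚ (vacancy n L ν a i)
  vac≡vacancy n L ν a i = begin
    nat→ℚ (Lmin L a i) ℚ.- 1/tv ℚ.* sumℚ (map term (oneTo n))
      ≡⟨ cong (λ S → nat→ℚ (Lmin L a i) ℚ.- 1/tv ℚ.* S) weighted-sum ⟩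
    nat→ℚ (Lmin L a i) ℚ.- 1/tv ℚ.* (tv n a ℚ.* ℤ→ℚ C)
      ≡⟨ cong (ℚ._-_ (nat→ℚ (Lmin L a i))) cancel ⟩
    nat→ℚ (Lmin L a i) ℚ.- ℤ→ℚ C
      ≡⟨ ≡.sym (ℤ→ℚ-minus (+ Lmin L a i) C) ⟩
    ℤ→ℚ (vacancy n L ν a i) ∎
    where
    1/tv : ℚ
    1/tv = (1/ tv n a) {{tv-nz n a}}
    C : ℤ
    C = cartanSum n a (λ b → + Q i (ν b))
    term : ℕ → ℚ
    term b = ip n a b ℚ.* sumℚ (map (λ j → (t n b ℚ.* υ n a ℚ.* nat→ℚ i) ℚ.⊓ (t n a ℚ.* υ n b ℚ.* nat→ℚ j)) (ν b))
    term≡ : ∀ b → term b ≡ tv n a ℚ.* ℤ→ℚ (cartan n a b ℤ.* + Q i (ν b))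
    term≡ b rewrite t≡1 n a | t≡1 n b | tv≡cv n a = begin
      ℤ→ℚ (+ cv n a) ℚ.* ℤ→ℚ (cartan n a b) ℚ.* _
        ≡⟨ cong (ℤ→ℚ (+ cv n a) ℚ.* ℤ→ℚ (cartan n a b) ℚ.*_) (trans
             (cong sumℚ (map-cong (λ j → cong₂ ℚ._⊓_ (ℚ.*-identityˡ (nat→ℚ i)) (ℚ.*-identityˡ (nat→ℚ j))) (ν b)))
             (Q-as-sumℚ i (ν b))) ⟩
      ℤ→ℚ (+ cv n a) ℚ.* ℤ→ℚ (cartan n a b) ℚ.* ℤ→ℚ (+ Q i (ν b))
        ≡⟨ ℚ.*-assoc (ℤ→ℚ (+ cv n a)) _ _ ⟩
      ℤ→ℚ (+ cv n a) ℚ.* (ℤ→ℚ (cartan n a b) ℚ.* ℤ→ℚ (+ Q i (ν b)))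
        ≡⟨ cong (ℤ→ℚ (+ cv n a) ℚ.*_) (≡.sym (ℤ→ℚ-* (cartan n a b) (+ Q i (ν b)))) ⟩
      ℤ→ℚ (+ cv n a) ℚ.* ℤ→ℚ (cartan n a b ℤ.* + Q i (ν b)) ∎
    weighted-sum : sumℚ (map term (oneTo n)) ≡ tv n a ℚ.* ℤ→ℚ C
    weighted-sum = begin
      sumℚ (map term (oneTo n))
        ≡⟨ cong sumℚ (map-cong term≡ (oneTo n)) ⟩
      sumℚ (map (λ b → tv n a ℚ.* ℤ→ℚ (cartan n a b ℤ.* + Q i (ν b))) (oneTo n))
        ≡⟨ sumℚ-*ˡ (tv n a) _ (oneTo n) ⟩
      tv n a ℚ.* sumℚ (map (λ b → ℤ→ℚ (cartan n a b ℤ.* + Q i (ν b))) (oneTo n))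
        ≡⟨ cong (tv n a ℚ.*_) (ℤ→ℚ-sum (λ b → cartan n a b ℤ.* + Q i (ν b)) (oneTo n)) ⟩
      tv n a ℚ.* ℤ→ℚ C ∎
    cancel : 1/tv ℚ.* (tv n a ℚ.* ℤ→ℚ C) ≡ ℤ→ℚ C
    cancel = begin
      1/tv ℚ.* (tv n a ℚ.* ℤ→ℚ C) ≡⟨ ≡.sym (ℚ.*-assoc 1/tv (tv n a) (ℤ→ℚ C)) ⟩
      1/tv ℚ.* tv n a ℚ.* ℤ→ℚ C   ≡⟨ cong (ℚ._* ℤ→ℚ C) (ℚ.*-inverseˡ (tv n a) {{tv-nz n a}}) ⟩
      ℚ.1ℚ ℚ.* ℤ→ℚ C              ≡⟨ ℚ.*-identityˡ (ℤ→ℚ C) ⟩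
      ℤ→ℚ C                       ∎

module CartanRowSums where

  open import Data.Bool using (true; false; T; _∧_)
  open import Data.Nat as ℕ using (ℕ; zero; suc; _≡ᵇ_; _∸_; _≤_; _<_; z≤n; s≤s)
  import Data.Nat.Properties as ℕ
  open import Data.Integer as ℤ using (ℤ; +_; _+_; _-_; _*_; -_)
  import Data.Integer.Properties as ℤ
  open import Data.Integer.Tactic.RingSolver using (solve-∀)
  open import Data.List using (map; upTo; applyUpTo)
  open import Data.List.Properties using (map-upTo; map-applyUpTo)
  open import Data.Empty using (⊥-elim)
  open import Function using (_∘_)
  open import Relation.Binary.PropositionalEquality
  open ≡-Reasoning
  open IntegralVacancy using (cartanSum)

  ≡ᵇ-refl : ∀ m → (m ≡ᵇ m) ≡ true
  ≡ᵇ-refl m with m ≡ᵇ m | ℕ.≡⇒≡ᵇ m m refl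
  ... | true | _ = refl

  ≢⇒≡ᵇ-false : ∀ {m n} → m ≢ n → (m ≡ᵇ n) ≡ false
  ≢⇒≡ᵇ-false {m} {n} m≢n with m ≡ᵇ n in eq
  ... | false = refl
  ... | true  = ⊥-elim (m≢n (ℕ.≡ᵇ⇒≡ m n (subst T (sym eq) _)))

  cartan-diag : ∀ n a → cartan n a a ≡ + 2
  cartan-diag n a rewrite ≡ᵇ-refl a = refl

  cartan-far-above : ∀ n a b → suc (suc a) ≤ b → cartan n a b ≡ + 0
  cartan-far-above n a b a+2≤b
    with a<b ← ℕ.<-trans (ℕ.n<1+n a) a+2≤b
    rewrite ≢⇒≡ᵇ-false (ℕ.<⇒≢ a<b) | ≢⇒≡ᵇ-false (ℕ.<⇒≢ a+2≤b) | ≢⇒≡ᵇ-false (ℕ.>⇒≢ (s≤s (ℕ.<⇒≤ a<b)))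
    = refl

  cartan-far-below : ∀ n a b → suc (suc b) ≤ a → cartan n a b ≡ + 0
  cartan-far-below n a b b+2≤a
    with b<a ← ℕ.<-trans (ℕ.n<1+n b) b+2≤a
    rewrite ≢⇒≡ᵇ-false (ℕ.>⇒≢ b<a) | ≢⇒≡ᵇ-false (ℕ.>⇒≢ (s≤s (ℕ.<⇒≤ b<a))) | ≢⇒≡ᵇ-false (ℕ.<⇒≢ b+2≤a)
    = refl

  ≡ᵇ∧+2≡ᵇ-false : ∀ a n → ((a ≡ᵇ n) ∧ (suc (suc a) ≡ᵇ n)) ≡ false
  ≡ᵇ∧+2≡ᵇ-false a n with a ≡ᵇ n in eq
  ... | false = refl
  ... | true rewrite ℕ.≡ᵇ⇒≡ a n (subst T (sym eq) _) = ≢⇒≡ᵇ-false (ℕ.>⇒≢ (ℕ.<-trans (ℕ.n<1+n n) (ℕ.n<1+n (suc n))))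

  cartan-succ : ∀ n a → 1 ≤ a → cartan n a (suc a) ≡ - + 1
  cartan-succ n a 1≤a
    rewrite ≢⇒≡ᵇ-false (ℕ.<⇒≢ (ℕ.n<1+n a)) | ≡ᵇ-refl a | ≢⇒≡ᵇ-false (ℕ.>⇒≢ 1≤a) | ≡ᵇ∧+2≡ᵇ-false a n
    = refl

  cartan-pred : ∀ n b → 1 ≤ b → suc b ≢ n → cartan n (suc b) b ≡ - + 1
  cartan-pred n b 1≤b b+1≢n
    rewrite ≢⇒≡ᵇ-false (ℕ.>⇒≢ (ℕ.n<1+n b)) | ≢⇒≡ᵇ-false (ℕ.>⇒≢ (ℕ.<-trans (ℕ.n<1+n b) (ℕ.n<1+n (suc b))))
          | ≡ᵇ-refl b | ≢⇒≡ᵇ-false b+1≢n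
    = refl

  cartan-last : ∀ m → cartan (suc m) (suc m) m ≡ - + 2
  cartan-last m
    rewrite ≢⇒≡ᵇ-false (ℕ.>⇒≢ (ℕ.n<1+n m)) | ≢⇒≡ᵇ-false (ℕ.>⇒≢ (ℕ.<-trans (ℕ.n<1+n m) (ℕ.n<1+n (suc m))))
          | ≡ᵇ-refl m
    = refl

  Σ< : ℕ → (ℕ → ℤ) → ℤ
  Σ< zero    F = + 0
  Σ< (suc m) F = F 0 + Σ< m (F ∘ suc)

  Σ<-suc : ∀ m F → Σ< (suc m) F ≡ Σ< m F + F m
  Σ<-suc zero    F = trans (ℤ.+-identityʳ (F 0)) (sym (ℤ.+-identityˡ (F 0)))
  Σ<-suc (suc m) F = trans (cong (_+_ (F 0)) (Σ<-suc m (F ∘ suc))) (sym (ℤ.+-assoc (F 0) _ _))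

  Σ<-zero : ∀ m F → (∀ x → x < m → F x ≡ + 0) → Σ< m F ≡ + 0
  Σ<-zero zero    F F≡0 = refl
  Σ<-zero (suc m) F F≡0 = cong₂ _+_ (F≡0 0 (s≤s z≤n)) (Σ<-zero m (F ∘ suc) (λ x x<m → F≡0 (suc x) (s≤s x<m)))

  Σ<-cong : ∀ m F F′ → (∀ x → x < m → F x ≡ F′ x) → Σ< m F ≡ Σ< m F′
  Σ<-cong zero    F F′ eq = refl
  Σ<-cong (suc m) F F′ eq = cong₂ _+_ (eq 0 (s≤s z≤n)) (Σ<-cong m (F ∘ suc) (F′ ∘ suc) (λ x x<m → eq (suc x) (s≤s x<m)))

  Σ<-support : ∀ m d F → (∀ x → m ≤ x → F x ≡ + 0) → Σ< (d ℕ.+ m) F ≡ Σ< m F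
  Σ<-support m zero    F F≡0 = refl
  Σ<-support m (suc d) F F≡0 = begin
    Σ< (suc (d ℕ.+ m)) F             ≡⟨ Σ<-suc (d ℕ.+ m) F ⟩
    Σ< (d ℕ.+ m) F + F (d ℕ.+ m)     ≡⟨ cong₂ _+_ (Σ<-support m d F F≡0) (F≡0 (d ℕ.+ m) (ℕ.m≤n+m m d)) ⟩
    Σ< m F + + 0                     ≡⟨ ℤ.+-identityʳ (Σ< m F) ⟩
    Σ< m F                           ∎

  sum-oneTo : ∀ g n → sumℤ (map g (oneTo n)) ≡ Σ< n (g ∘ suc)
  sum-oneTo g n = begin
    sumℤ (map g (map suc (upTo n)))   ≡⟨ cong (sumℤ ∘ map g) (map-upTo suc n) ⟩
    sumℤ (map g (applyUpTo suc n))    ≡⟨ cong sumℤ (map-applyUpTo suc g n) ⟩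
    sumℤ (applyUpTo (g ∘ suc) n)      ≡⟨ sum-applyUpTo (g ∘ suc) n ⟩
    Σ< n (g ∘ suc)                    ∎
    where
    sum-applyUpTo : ∀ F n → sumℤ (applyUpTo F n) ≡ Σ< n F
    sum-applyUpTo F zero    = refl
    sum-applyUpTo F (suc n) = cong (_+_ (F 0)) (sum-applyUpTo (F ∘ suc) n)

  cartanSum-cong : ∀ n a (f g : ℕ → ℤ) → (∀ b → 1 ≤ b → b ≤ n → f b ≡ g b) → cartanSum n a f ≡ cartanSum n a g
  cartanSum-cong n a f g f≡g = begin
    cartanSum n a f                                ≡⟨ sum-oneTo (λ b → cartan n a b * f b) n ⟩
    Σ< n (λ x → cartan n a (suc x) * f (suc x))    ≡⟨ Σ<-cong n _ _ (λ x x<n → cong (cartan n a (suc x) *_) (f≡g (suc x) (s≤s z≤n) x<n)) ⟩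
    Σ< n (λ x → cartan n a (suc x) * g (suc x))    ≡⟨ sym (sum-oneTo (λ b → cartan n a b * g b) n) ⟩
    cartanSum n a g                                ∎

  cartanSum-inner : ∀ n a (f : ℕ → ℤ) → 1 ≤ a → a < n → f 0 ≡ + 0 →
    cartanSum n a f ≡ (f a + f a) - f (a ∸ 1) - f (suc a)
  cartanSum-inner n (suc a) f _ a+1<n f0≡0 = begin
    cartanSum n (suc a) f
      ≡⟨ sum-oneTo (λ b → cartan n (suc a) b * f b) n ⟩
    Σ< n F
      ≡⟨ cong (λ m → Σ< m F) (sym (ℕ.m∸n+n≡m a+1<n)) ⟩
    Σ< (n ∸ suc (suc a) ℕ.+ suc (suc a)) F
      ≡⟨ Σ<-support (suc (suc a)) (n ∸ suc (suc a)) F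
           (λ x a+2≤x → cong (_* f (suc x)) (cartan-far-above n (suc a) (suc x) (s≤s a+2≤x))) ⟩
    Σ< (suc (suc a)) F
      ≡⟨ Σ<-suc (suc a) F ⟩
    Σ< (suc a) F + F (suc a)
      ≡⟨ cong (_+ F (suc a)) (Σ<-suc a F) ⟩
    Σ< a F + F a + F (suc a)
      ≡⟨ cong₂ (λ u v → u + v * f (suc a) + F (suc a)) (below a refl) (cartan-diag n (suc a)) ⟩
    - f a + + 2 * f (suc a) + F (suc a)
      ≡⟨ cong (λ v → - f a + + 2 * f (suc a) + v * f (suc (suc a))) (cartan-succ n (suc a) (s≤s z≤n)) ⟩
    - f a + + 2 * f (suc a) + - + 1 * f (suc (suc a))
      ≡⟨ rearrange (f a) (f (suc a)) (f (suc (suc a))) ⟩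
    (f (suc a) + f (suc a)) - f a - f (suc (suc a)) ∎
    where
    F : ℕ → ℤ
    F x = cartan n (suc a) (suc x) * f (suc x)
    rearrange : ∀ x y z → - x + + 2 * y + - + 1 * z ≡ (y + y) - x - z
    rearrange = solve-∀
    below : ∀ b → b ≡ a → Σ< b F ≡ - f b
    below zero    _    = cong -_ (sym f0≡0)
    below (suc b) refl = begin
      Σ< (suc b) F                               ≡⟨ Σ<-suc b F ⟩
      Σ< b F + F b                               ≡⟨ cong₂ _+_ (Σ<-zero b F far) (cong (_* f (suc b)) (cartan-pred n (suc b) (s≤s z≤n) (ℕ.<⇒≢ a+1<n))) ⟩
      + 0 + - + 1 * f (suc b)                    ≡⟨ neg (f (suc b)) ⟩
      - f (suc b)                                ∎
      where
      far : ∀ x → x < b → F x ≡ + 0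
      far x x<b = cong (_* f (suc x)) (cartan-far-below n (suc (suc b)) (suc x) (s≤s (s≤s x<b)))
      neg : ∀ y → + 0 + - + 1 * y ≡ - y
      neg = solve-∀

  cartanSum-last : ∀ n (f : ℕ → ℤ) → 2 ≤ n → cartanSum n n f ≡ (f n + f n) - (f (n ∸ 1) + f (n ∸ 1))
  cartanSum-last (suc zero) f (s≤s ())
  cartanSum-last (suc (suc m)) f _ = begin
    cartanSum n n f                     ≡⟨ sum-oneTo (λ b → cartan n n b * f b) n ⟩
    Σ< (suc (suc m)) F                  ≡⟨ Σ<-suc (suc m) F ⟩
    Σ< (suc m) F + F (suc m)            ≡⟨ cong (_+ F (suc m)) (Σ<-suc m F) ⟩
    Σ< m F + F m + F (suc m)
      ≡⟨ cong₂ (λ u v → u + v * f (suc m) + F (suc m)) (Σ<-zero m F far) (cartan-last (suc m)) ⟩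
    + 0 + - + 2 * f (suc m) + F (suc m) ≡⟨ cong (λ v → + 0 + - + 2 * f (suc m) + v * f n) (cartan-diag n n) ⟩
    + 0 + - + 2 * f (suc m) + + 2 * f n ≡⟨ rearrange (f (suc m)) (f n) ⟩
    (f n + f n) - (f (suc m) + f (suc m)) ∎
    where
    n : ℕ
    n = suc (suc m)
    F : ℕ → ℤ
    F x = cartan n n (suc x) * f (suc x)
    far : ∀ x → x < m → F x ≡ + 0
    far x x<m = cong (_* f (suc x)) (cartan-far-below n n (suc x) (s≤s (s≤s x<m)))
    rearrange : ∀ x y → + 0 + - + 2 * x + + 2 * y ≡ (y + y) - (x + x)
    rearrange = solve-∀

module Partitions where

  open import Data.Nat using (ℕ; zero; suc; _+_; _∸_; _≤_; _<_; _⊓_; z≤n; s≤s; pred; _≤?_)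
  open import Data.Nat.Properties
  open import Data.Nat.Tactic.RingSolver using (solve-∀)
  open import Data.List using (List; []; _∷_; map; drop; length)
  open import Data.List.Properties using (drop-[])
  open import Data.List.Relation.Unary.All as All using (All; []; _∷_)
  open import Data.Product using (_,_)
  open import Data.Empty using (⊥-elim)
  open import Relation.Nullary using (yes; no)
  open import Relation.Binary.Definitions using (tri<; tri≈; tri>)
  open import Relation.Binary.PropositionalEquality
  open IntegralVacancy using (Q)

  𝟙[_≤_] : ℕ → ℕ → ℕ
  𝟙[ j ≤ x ] with j ≤? x
  ... | yes _ = 1
  ... | no  _ = 0

  𝟙-yes : ∀ {j x} → j ≤ x → 𝟙[ j ≤ x ] ≡ 1
  𝟙-yes {j} {x} j≤x with j ≤? x
  ... | yes _   = refl
  ... | no  j≰x = ⊥-elim (j≰x j≤x)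

  𝟙-no : ∀ {j x} → x < j → 𝟙[ j ≤ x ] ≡ 0
  𝟙-no {j} {x} x<j with j ≤? x
  ... | yes j≤x = ⊥-elim (<-irrefl refl (<-≤-trans x<j j≤x))
  ... | no  _   = refl

  parts≥ : ℕ → List ℕ → ℕ
  parts≥ j []      = 0
  parts≥ j (x ∷ μ) = 𝟙[ j ≤ x ] + parts≥ j μ

  largest : List ℕ → ℕ
  largest []      = 0
  largest (x ∷ _) = x

  Q-zero : ∀ μ → Q 0 μ ≡ 0
  Q-zero []      = refl
  Q-zero (x ∷ μ) = Q-zero μ

  Q-suc : ∀ i μ → Q (suc i) μ ≡ Q i μ + parts≥ (suc i) μ
  Q-suc i []      = refl
  Q-suc i (x ∷ μ) = trans (cong₂ _+_ (⊓-suc x) (Q-suc i μ)) (interchange (i ⊓ x) _ (Q i μ) _)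
    where
    interchange : ∀ a b c d → (a + b) + (c + d) ≡ (a + c) + (b + d)
    interchange = solve-∀
    ⊓-suc : ∀ x → suc i ⊓ x ≡ i ⊓ x + 𝟙[ suc i ≤ x ]
    ⊓-suc x with suc i ≤? x
    ... | yes i<x = trans (m≤n⇒m⊓n≡m i<x) (trans (+-comm 1 i) (cong (_+ 1) (sym (m≤n⇒m⊓n≡m (<⇒≤ i<x)))))
    ... | no  i≮x = trans (m≥n⇒m⊓n≡n (<⇒≤ (≰⇒> i≮x))) (sym (trans (+-identityʳ _) (m≥n⇒m⊓n≡n (≤-pred (≰⇒> i≮x)))))

  parts≥-antitone : ∀ j μ → parts≥ (suc j) μ ≤ parts≥ j μ
  parts≥-antitone j []      = z≤n
  parts≥-antitone j (x ∷ μ) = +-mono-≤ (𝟙-antitone x) (parts≥-antitone j μ)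
    where
    𝟙-antitone : ∀ x → 𝟙[ suc j ≤ x ] ≤ 𝟙[ j ≤ x ]
    𝟙-antitone x with suc j ≤? x
    ... | yes j<x = ≤-reflexive (sym (𝟙-yes (<⇒≤ j<x)))
    ... | no  _   = z≤n

  parts≥-none : ∀ {j μ} → All (_< j) μ → parts≥ j μ ≡ 0
  parts≥-none []             = refl
  parts≥-none (x<j ∷ μ<j) = cong₂ _+_ (𝟙-no x<j) (parts≥-none μ<j)

  parts≥-positive : ∀ {μ} → All (1 ≤_) μ → parts≥ 1 μ ≡ length μ
  parts≥-positive []             = refl
  parts≥-positive (1≤x ∷ μ>0) = cong₂ _+_ (𝟙-yes 1≤x) (parts≥-positive μ>0)

  Decreasing-tail : ∀ {x μ} → Decreasing (x ∷ μ) → Decreasing μ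
  Decreasing-tail [ _ ]   = []
  Decreasing-tail (_ ∷ d) = d

  Decreasing-bounded : ∀ {x μ} → Decreasing (x ∷ μ) → All (_≤ x) μ
  Decreasing-bounded [ _ ]       = []
  Decreasing-bounded (y≤x ∷ d) = y≤x ∷ All.map (λ z≤y → ≤-trans z≤y y≤x) (Decreasing-bounded d)

  Decreasing-cons : ∀ {x μ} → Decreasing μ → largest μ ≤ x → Decreasing (x ∷ μ)
  Decreasing-cons {x} []      _   = [ x ]
  Decreasing-cons [ y ]       y≤x = y≤x ∷ [ y ]
  Decreasing-cons (z≤y ∷ d)   y≤x = y≤x ∷ (z≤y ∷ d)

  Decreasing-drop : ∀ m {μ} → Decreasing μ → Decreasing (drop m μ)
  Decreasing-drop zero    d         = d
  Decreasing-drop (suc m) []        = []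
  Decreasing-drop (suc m) [ _ ]     = subst Decreasing (sym (drop-[] m)) []
  Decreasing-drop (suc m) (_ ∷ d)   = Decreasing-drop m d

  IsPartition-drop : ∀ m {μ} → IsPartition μ → IsPartition (drop m μ)
  IsPartition-drop m (d , μ>0) = Decreasing-drop m d , All-drop m μ>0
    where
    All-drop : ∀ {P : ℕ → Set} m {μ} → All P μ → All P (drop m μ)
    All-drop zero    ps       = ps
    All-drop (suc m) []       = []
    All-drop (suc m) (_ ∷ ps) = All-drop m ps

  largest-drop-antitone : ∀ {μ} → Decreasing μ → ∀ m → largest (drop (suc m) μ) ≤ largest (drop m μ)
  largest-drop-antitone []        _       = z≤n
  largest-drop-antitone [ _ ]     zero    = z≤n
  largest-drop-antitone (y≤x ∷ _) zero    = y≤x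
  largest-drop-antitone [ _ ]     (suc m) = z≤n
  largest-drop-antitone (_ ∷ d)   (suc m) = largest-drop-antitone d m

  All≤largest : ∀ {μ} → Decreasing μ → All (_≤ largest μ) μ
  All≤largest []        = []
  All≤largest [ _ ]     = ≤-refl ∷ []
  All≤largest (y≤x ∷ d) = ≤-refl ∷ Decreasing-bounded (y≤x ∷ d)

  sum-map-drop : ∀ (ψ : ℕ → ℕ) → ψ 0 ≡ 0 → ∀ m μ →
    sumℕ (map ψ (drop m μ)) ≡ ψ (largest (drop m μ)) + sumℕ (map ψ (drop (suc m) μ))
  sum-map-drop ψ ψ0≡0 zero    []      = sym (trans (+-identityʳ (ψ 0)) ψ0≡0)
  sum-map-drop ψ ψ0≡0 zero    (x ∷ μ) = refl
  sum-map-drop ψ ψ0≡0 (suc m) []      = sym (trans (+-identityʳ (ψ 0)) ψ0≡0)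
  sum-map-drop ψ ψ0≡0 (suc m) (x ∷ μ) = sum-map-drop ψ ψ0≡0 m μ

  parts≥-drop : ∀ {μ} → Decreasing μ → ∀ m j → parts≥ j (drop m μ) ≡ parts≥ j μ ∸ m
  parts≥-drop           d zero    j = refl
  parts≥-drop {[]}      d (suc m) j = refl
  parts≥-drop {x ∷ μ}   d (suc m) j with j ≤? x
  ... | yes _   = parts≥-drop (Decreasing-tail d) m j
  ... | no  j≰x = begin
    parts≥ j (drop m μ)   ≡⟨ parts≥-drop (Decreasing-tail d) m j ⟩
    parts≥ j μ ∸ m        ≡⟨ cong (_∸ m) none ⟩
    0 ∸ m                 ≡⟨ 0∸n≡0 m ⟩
    0                     ≡⟨ cong (_∸ suc m) (sym none) ⟩
    parts≥ j μ ∸ suc m    ∎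
    where
    open ≡-Reasoning
    none : parts≥ j μ ≡ 0
    none = parts≥-none (All.map (λ y≤x → ≤-<-trans y≤x (≰⇒> j≰x)) (Decreasing-bounded d))

  parts≥-beyond-largest : ∀ {x μ j} → Decreasing (x ∷ μ) → x < j → parts≥ j (x ∷ μ) ≡ 0
  parts≥-beyond-largest d x<j = parts≥-none (x<j ∷ All.map (λ y≤x → ≤-<-trans y≤x x<j) (Decreasing-bounded d))

  parts≥-separates : ∀ {x y μ κ} → Decreasing (x ∷ μ) → x < y →
    parts≥ (suc (pred y)) (x ∷ μ) ≢ parts≥ (suc (pred y)) (y ∷ κ)
  parts≥-separates {y = suc y} {κ = κ} d x<y eq
    rewrite 𝟙-yes {suc y} {suc y} ≤-refl
    with () ← trans (sym eq) (parts≥-beyond-largest d x<y)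

  partition-ext : ∀ {μ κ} → IsPartition μ → IsPartition κ →
    (∀ j → parts≥ (suc j) μ ≡ parts≥ (suc j) κ) → μ ≡ κ
  partition-ext {[]}    {[]}    _ _ _ = refl
  partition-ext {[]}    {y ∷ κ} _ (_ , 1≤y ∷ _) cols with () ← trans (cols 0) (cong (_+ parts≥ 1 κ) (𝟙-yes 1≤y))
  partition-ext {x ∷ μ} {[]}    (_ , 1≤x ∷ _) _ cols with () ← trans (sym (cols 0)) (cong (_+ parts≥ 1 μ) (𝟙-yes 1≤x))
  partition-ext {x ∷ μ} {y ∷ κ} (dμ , _ ∷ μ>0) (dκ , _ ∷ κ>0) cols with <-cmp x y
  ... | tri≈ _ refl _ = cong (x ∷_) (partition-ext (Decreasing-tail dμ , μ>0) (Decreasing-tail dκ , κ>0)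
                                       (λ j → +-cancelˡ-≡ 𝟙[ suc j ≤ x ] _ _ (cols j)))
  ... | tri< x<y _ _  = ⊥-elim (parts≥-separates {κ = κ} dμ x<y (cols (pred y)))
  ... | tri> _ _ y<x  = ⊥-elim (parts≥-separates {κ = μ} dκ y<x (sym (cols (pred x))))

  entries-ext : ∀ r {μ κ} → All (1 ≤_) μ → All (1 ≤_) κ → length μ ≤ r → length κ ≤ r →
    (∀ d → d < r → largest (drop d μ) ≡ largest (drop d κ)) → μ ≡ κ
  entries-ext r       {[]}    {[]}    _ _ _ _ _ = refl
  entries-ext (suc r) {[]}    {y ∷ κ} _ (1≤y ∷ _) _ _ eq with () ← subst (1 ≤_) (sym (eq 0 (s≤s z≤n))) 1≤y
  entries-ext (suc r) {x ∷ μ} {[]}    (1≤x ∷ _) _ _ _ eq with () ← subst (1 ≤_) (eq 0 (s≤s z≤n)) 1≤x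
  entries-ext (suc r) {x ∷ μ} {y ∷ κ} (_ ∷ μ>0) (_ ∷ κ>0) (s≤s ℓμ≤r) (s≤s ℓκ≤r) eq =
    cong₂ _∷_ (eq 0 (s≤s z≤n)) (entries-ext r μ>0 κ>0 ℓμ≤r ℓκ≤r (λ d d<r → eq (suc d) (s≤s d<r)))

module DiscreteConvexity where

  open import Data.Nat using (ℕ; zero; suc; _+_; _∸_; _≤_; _<_; z≤n; s≤s; pred; _≤?_; _≟_)
  open import Data.Nat.Properties
  open import Data.Nat.Tactic.RingSolver using (solve-∀)
  open import Data.Sum using (inj₁; inj₂)
  open import Relation.Nullary using (yes; no)
  open import Relation.Binary.PropositionalEquality
  open import Data.Empty using (⊥)

  module _ {P : ℕ → Set} {m n : ℕ} where

    ascend : P m → (∀ a → m ≤ a → a < n → P a → P (suc a)) → ∀ a → m ≤ a → a ≤ n → P a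
    ascend base step zero    m≤0   _     = subst P (n≤0⇒n≡0 m≤0) base
    ascend base step (suc a) m≤1+a 1+a≤n with m≤n⇒m<n∨m≡n m≤1+a
    ... | inj₂ refl = base
    ... | inj₁ m<1+a = step a (≤-pred m<1+a) 1+a≤n (ascend base step a (≤-pred m<1+a) (<⇒≤ 1+a≤n))

    descend : P n → (∀ a → m ≤ a → a < n → P (suc a) → P a) → ∀ a → m ≤ a → a ≤ n → P a
    descend base step a m≤a a≤n = go (n ∸ a) a m≤a (m+[n∸m]≡n a≤n)
      where
      go : ∀ d a → m ≤ a → a + d ≡ n → P a
      go zero    a _   a+0≡n = subst P (trans (sym a+0≡n) (+-identityʳ a)) base
      go (suc d) a m≤a a+d+1≡n =
        step a m≤a (subst (a <_) a+d+1≡n (m<m+n a (s≤s z≤n)))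
             (go d (suc a) (m≤n⇒m≤1+n m≤a) (trans (sym (+-suc a d)) a+d+1≡n))

  convex-≤ˡ : ∀ {u v w} → u + u ≤ v + w → w ≤ u → u ≤ v
  convex-≤ˡ {u} {v} {w} 2u≤v+w w≤u = +-cancelʳ-≤ u u v (≤-trans 2u≤v+w (+-monoʳ-≤ v w≤u))

  convex-≤ʳ : ∀ {u v w} → u + u ≤ v + w → v ≤ u → u ≤ w
  convex-≤ʳ {u} {v} {w} 2u≤v+w v≤u = +-cancelˡ-≤ u u w (≤-trans 2u≤v+w (+-monoˡ-≤ w v≤u))

  convex-≤ˡ-suc : ∀ {u v w} → u + u ≤ v + w → w ≤ suc u → u ≤ suc v
  convex-≤ˡ-suc {u} {v} {w} 2u≤v+w w≤1+u =
    +-cancelʳ-≤ u u (suc v) (≤-trans 2u≤v+w (≤-trans (+-monoʳ-≤ v w≤1+u) (≤-reflexive (+-suc v u))))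

  m≤o∸n⇒n≤o∸m : ∀ {m n o} → n ≤ o → m ≤ o ∸ n → n ≤ o ∸ m
  m≤o∸n⇒n≤o∸m {m} {n} {o} n≤o m≤o∸n = m+n≤o⇒m≤o∸n n (subst (_≤ o) (+-comm m n) (m≤o∸n⇒m+n≤o m n≤o m≤o∸n))

  stair-rise : ∀ h r a → a ≤ r → r ∸ h < a → h ∸ (r ∸ a) ≡ suc (h ∸ (r ∸ (a ∸ 1)))
  stair-rise h r (suc a) a<r r∸h≤a =
    trans (+-∸-assoc 1 r∸a<h) (cong (λ m → suc (h ∸ m)) (sym (+-∸-assoc 1 a<r)))
    where
    r∸a<h : r ∸ suc a < h
    r∸a<h = ∸-cancelʳ-< (subst (r ∸ h <_) (sym (m∸[m∸n]≡n a<r)) r∸h≤a)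

  -- x a is the next column of ν^{(a)}, h the previous column of ν^{(r)}, e ∈ {0,1} the growth of min(i,s)
  module Staircase (n r h e : ℕ) (x : ℕ → ℕ) (r<n : r < n) (h≤r : h ≤ r) (e≤1 : e ≤ 1)
    (zero-below   : ∀ a → a ≤ r ∸ h → x a ≡ 0)
    (convex-below : ∀ a → r ∸ h < a → a < r → x a + x a ≤ x (a ∸ 1) + x (suc a))
    (convex-at-r  : 1 ≤ h → x r + x r ≤ e + x (r ∸ 1) + x (suc r))
    (convex-above : ∀ a → r < a → a < n → x a + x a ≤ x (a ∸ 1) + x (suc a))
    (end          : x n ≤ x (n ∸ 1)) where

    private
      k : ℕ
      k = r ∸ h

    antitone-above : ∀ a → r < a → a ≤ n → x a ≤ x (a ∸ 1)
    antitone-above = descend end (λ a r<a a<n next → convex-≤ˡ (convex-above a r<a a<n) next)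

    monotone-below : ∀ a → k < a → a ≤ r → x (a ∸ 1) ≤ x a
    monotone-below = ascend base (λ a k<a a<r prev → convex-≤ʳ (convex-below a k<a a<r) prev)
      where
      base : x k ≤ x (suc k)
      base = subst (_≤ x (suc k)) (sym (zero-below k ≤-refl)) z≤n

    flat⇒zero : ∀ a → k < a → a ≤ r → x a ≤ x (a ∸ 1) → x a ≡ 0
    flat⇒zero = ascend base step
      where
      base : x (suc k) ≤ x k → x (suc k) ≡ 0
      base flat = n≤0⇒n≡0 (subst (x (suc k) ≤_) (zero-below k ≤-refl) flat)
      step : ∀ a → suc k ≤ a → a < r → (x a ≤ x (a ∸ 1) → x a ≡ 0) → x (suc a) ≤ x a → x (suc a) ≡ 0
      step a k<a a<r ih flat =
        n≤0⇒n≡0 (subst (x (suc a) ≤_) (ih (convex-≤ˡ (convex-below a k<a a<r) flat)) flat)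

    rise≤1 : x r ≤ suc (x (r ∸ 1)) → ∀ a → k < a → a ≤ r → x a ≤ suc (x (a ∸ 1))
    rise≤1 top = descend top (λ a k<a a<r next → convex-≤ˡ-suc (convex-below a k<a a<r) next)

    staircase : x r ≤ suc (x (r ∸ 1)) → ∀ a → k ≤ a → a ≤ r → x a ≡ x r ∸ (r ∸ a)
    staircase top = descend (cong (x r ∸_) (sym (n∸n≡0 r))) step
      where
      step : ∀ a → k ≤ a → a < r → x (suc a) ≡ x r ∸ (r ∸ suc a) → x a ≡ x r ∸ (r ∸ a)
      step a k≤a a<r next = begin
        x a                       ≡⟨ x≡pred ⟩
        pred (x (suc a))          ≡⟨ cong pred next ⟩
        pred (x r ∸ (r ∸ suc a))  ≡⟨ pred[m∸n]≡m∸[1+n] (x r) (r ∸ suc a) ⟩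
        x r ∸ suc (r ∸ suc a)     ≡⟨ cong (x r ∸_) (sym (+-∸-assoc 1 a<r)) ⟩
        x r ∸ (r ∸ a)             ∎
        where
        open ≡-Reasoning
        x≡pred : x a ≡ pred (x (suc a))
        x≡pred with x (suc a) ≤? x a
        ... | yes flat = trans (n≤0⇒n≡0 (subst (x a ≤_) x[1+a]≡0 (monotone-below (suc a) (s≤s k≤a) a<r)))
                               (sym (cong pred x[1+a]≡0))
          where
          x[1+a]≡0 : x (suc a) ≡ 0
          x[1+a]≡0 = flat⇒zero (suc a) (s≤s k≤a) a<r flat
        ... | no rise  = cong pred (sym (≤-antisym (rise≤1 top (suc a) (s≤s k≤a) a<r) (≰⇒> rise)))

    1≤xr⇒1≤h : 1 ≤ x r → 1 ≤ h
    1≤xr⇒1≤h 1≤xr with h ≟ 0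
    ... | no  h≢0 = n≢0⇒n>0 h≢0
    ... | yes refl with () ← subst (1 ≤_) (zero-below r ≤-refl) 1≤xr

    convex-at-r′ : 1 ≤ x r → x r + x r ≤ x (r ∸ 1) + (x (suc r) + e)
    convex-at-r′ 1≤xr = subst (x r + x r ≤_) (rearrange e (x (r ∸ 1)) (x (suc r))) (convex-at-r (1≤xr⇒1≤h 1≤xr))
      where
      rearrange : ∀ e u w → e + u + w ≡ u + (w + e)
      rearrange = solve-∀

    collapse : x (suc r) + e ≤ x r → x r ≡ 0
    collapse fall with x r ≟ 0
    ... | yes xr≡0 = xr≡0
    ... | no  xr≢0 = flat⇒zero r k<r ≤-refl (convex-≤ˡ (convex-at-r′ 1≤xr) fall)
      where
      1≤xr : 1 ≤ x r
      1≤xr = n≢0⇒n>0 xr≢0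
      k<r : r ∸ h < r
      k<r = ∸-monoʳ-< {o = 0} (1≤xr⇒1≤h 1≤xr) h≤r

    flat-after-r : x (suc r) ≡ x r
    flat-after-r = ≤-antisym (antitone-above (suc r) ≤-refl r<n) (≮⇒≥ no-drop)
      where
      no-drop : x (suc r) < x r → ⊥
      no-drop lt with () ← subst (x (suc r) <_) (collapse (≤-trans (+-monoʳ-≤ (x (suc r)) e≤1)
                                                          (subst (_≤ x r) (+-comm 1 (x (suc r))) lt))) lt

    slack : 1 ≤ x r → e ≡ 1
    slack 1≤xr = ≤-antisym e≤1 (n≢0⇒n>0 e≢0)
      where
      e≢0 : e ≢ 0
      e≢0 refl with () ← subst (1 ≤_) (collapse (subst (_≤ x r) (sym (+-identityʳ (x (suc r))))
                                                   (≤-reflexive flat-after-r))) 1≤xr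

    rise≤1-at-r : x r ≤ suc (x (r ∸ 1))
    rise≤1-at-r with x r ≟ 0
    ... | yes xr≡0 = subst (_≤ suc (x (r ∸ 1))) (sym xr≡0) z≤n
    ... | no  xr≢0 = convex-≤ˡ-suc (convex-at-r′ (n≢0⇒n>0 xr≢0))
                       (≤-trans (+-monoʳ-≤ (x (suc r)) e≤1) (≤-reflexive (trans (+-comm (x (suc r)) 1) (cong suc flat-after-r))))

    rising-above : ∀ a → r < a → a ≤ n → x (a ∸ 1) ≤ x a
    rising-above = ascend (≤-reflexive (sym flat-after-r)) (λ a r<a a<n prev → convex-≤ʳ (convex-above a r<a a<n) prev)

    shape-above : ∀ a → r ≤ a → a ≤ n → x a ≡ x r
    shape-above = ascend refl step
      where
      step : ∀ a → r ≤ a → a < n → x a ≡ x r → x (suc a) ≡ x r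
      step a r≤a a<n ih = trans (≤-antisym (antitone-above (suc a) (s≤s r≤a) a<n) (rising-above (suc a) (s≤s r≤a) a<n)) ih

    height≤h : x r ≤ h
    height≤h = m∸n≡0⇒m≤n (begin
      x r ∸ h        ≡⟨ cong (x r ∸_) (sym (m∸[m∸n]≡n h≤r)) ⟩
      x r ∸ (r ∸ k)  ≡⟨ sym (staircase rise≤1-at-r k ≤-refl (m∸n≤m r h)) ⟩
      x k            ≡⟨ zero-below k ≤-refl ⟩
      0              ∎)
      where open ≡-Reasoning

    shape-below : ∀ a → a ≤ r → x a ≡ x r ∸ (r ∸ a)
    shape-below a a≤r with ≤-total k a
    ... | inj₁ k≤a = staircase rise≤1-at-r a k≤a a≤r
    ... | inj₂ a≤k = trans (zero-below a a≤k) (sym (m≤n⇒m∸n≡0 (≤-trans height≤h (m≤o∸n⇒n≤o∸m h≤r a≤k))))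

module Columns where

  open import Data.Nat using (ℕ; zero; suc; _+_; _∸_; _≤_; _<_; _⊓_; z≤n; s≤s)
  open import Data.Nat.Properties
  open import Data.Nat.Tactic.RingSolver using (solve-∀)
  open import Data.List using (List; [])
  open import Data.Empty using (⊥)
  open import Data.Product using (_×_; _,_; proj₁; proj₂)
  open import Relation.Binary.PropositionalEquality
  open IntegralVacancy using (Q)
  open Partitions
  open DiscreteConvexity

  convex-shift : ∀ A B C {T t u v w} → A + A ≡ T + B + C →
    (A + u) + (A + u) ≤ (T + t) + (B + v) + (C + w) → u + u ≤ t + v + w
  convex-shift A B C {T} {t} {u} {v} {w} 2A≡T+B+C ineq =
    +-cancelˡ-≤ (A + A) (u + u) (t + v + w)
      (subst₂ _≤_ (lhs A u) (trans (rhs T t B v C w) (cong (_+ (t + v + w)) (sym 2A≡T+B+C))) ineq)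
    where
    lhs : ∀ A u → (A + u) + (A + u) ≡ (A + A) + (u + u)
    lhs = solve-∀
    rhs : ∀ T t B v C w → (T + t) + (B + v) + (C + w) ≡ (T + B + C) + (t + v + w)
    rhs = solve-∀

  module ColumnInduction (n r s : ℕ) (ν : ℕ → List ℕ) (ν0≡[] : ν 0 ≡ []) (r<n : r < n)
    (convex-off-r : ∀ a j → 1 ≤ a → a < n → a ≢ r →
       Q (suc j) (ν a) + Q (suc j) (ν a) ≤ Q (suc j) (ν (a ∸ 1)) + Q (suc j) (ν (suc a)))
    (convex-at-r : ∀ j →
       Q (suc j) (ν r) + Q (suc j) (ν r) ≤ (suc j ⊓ s) + Q (suc j) (ν (r ∸ 1)) + Q (suc j) (ν (suc r)))
    (convex-end : ∀ j → Q (suc j) (ν n) ≤ Q (suc j) (ν (n ∸ 1))) where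

    q : ℕ → ℕ → ℕ
    q a j = Q j (ν a)

    x : ℕ → ℕ → ℕ
    x a j = parts≥ j (ν a)

    -- The state after the first j columns, h being the height of the j-th column of ν^{(r)}.
    record Level (j h : ℕ) : Set where
      field
        h≤r     : h ≤ r
        rising  : ∀ a → r ∸ h < a → a ≤ r → q a j ≡ q (a ∸ 1) j + j
        flat    : ∀ a → r ≤ a → a ≤ n → q a j ≡ q r j
        bounded : 1 ≤ h → j ≤ s
        empty   : ∀ a → a ≤ r ∸ h → x a (suc j) ≡ 0

    record Shape (j : ℕ) : Set where
      field
        below : ∀ a → a ≤ r → x a j ≡ x r j ∸ (r ∸ a)
        above : ∀ a → r ≤ a → a ≤ n → x a j ≡ x r j

    level-zero : Level 0 r
    level-zero = record
      { h≤r     = ≤-refl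
      ; rising  = λ a _ _ → trans (Q-zero (ν a)) (sym (trans (+-identityʳ _) (Q-zero (ν (a ∸ 1)))))
      ; flat    = λ a _ _ → trans (Q-zero (ν a)) (sym (Q-zero (ν r)))
      ; bounded = λ _ → z≤n
      ; empty   = λ a a≤r∸r → subst (λ b → x b 1 ≡ 0) (sym (n≤0⇒n≡0 (subst (a ≤_) (n∸n≡0 r) a≤r∸r)))
                                    (cong (parts≥ 1) ν0≡[])
      }

    module Step {j h : ℕ} (L : Level j h) where
      open Level L

      y : ℕ → ℕ
      y a = x a (suc j)

      e : ℕ
      e = (suc j ⊓ s) ∸ j

      e≤1 : e ≤ 1
      e≤1 = ≤-trans (∸-monoˡ-≤ j (m⊓n≤m (suc j) s)) (≤-reflexive (m+n∸n≡m 1 j))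

      q-suc : ∀ a → q a (suc j) ≡ q a j + y a
      q-suc a = Q-suc j (ν a)

      convex-y : ∀ {a T t} → q a j + q a j ≡ T + q (a ∸ 1) j + q (suc a) j →
        q a (suc j) + q a (suc j) ≤ (T + t) + q (a ∸ 1) (suc j) + q (suc a) (suc j) →
        y a + y a ≤ t + y (a ∸ 1) + y (suc a)
      convex-y {a} {T} {t} affine ineq = convex-shift (q a j) (q (a ∸ 1) j) (q (suc a) j) affine
        (subst₂ _≤_ (cong₂ _+_ (q-suc a) (q-suc a)) (cong₂ _+_ (cong ((T + t) +_) (q-suc (a ∸ 1))) (q-suc (suc a))) ineq)

      convex-below : ∀ a → r ∸ h < a → a < r → y a + y a ≤ y (a ∸ 1) + y (suc a)
      convex-below a k<a a<r =
        convex-y {T = 0} affine (convex-off-r a j (≤-trans (s≤s z≤n) k<a) (<-trans a<r r<n) (<⇒≢ a<r))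
        where
        affine : q a j + q a j ≡ q (a ∸ 1) j + q (suc a) j
        affine = begin
          q a j + q a j                    ≡⟨ cong (q a j +_) (rising a k<a (<⇒≤ a<r)) ⟩
          q a j + (q (a ∸ 1) j + j)        ≡⟨ swap (q a j) (q (a ∸ 1) j) j ⟩
          q (a ∸ 1) j + (q a j + j)        ≡⟨ cong (q (a ∸ 1) j +_) (sym (rising (suc a) (<-trans k<a (n<1+n a)) a<r)) ⟩
          q (a ∸ 1) j + q (suc a) j        ∎
          where
          open ≡-Reasoning
          swap : ∀ u v w → u + (v + w) ≡ v + (u + w)
          swap = solve-∀

      convex-r : 1 ≤ h → y r + y r ≤ e + y (r ∸ 1) + y (suc r)
      convex-r 1≤h = convex-y {T = j} affine (subst (λ m → _ ≤ m + _ + _) min≡j+e (convex-at-r j))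
        where
        min≡j+e : suc j ⊓ s ≡ j + e
        min≡j+e = sym (m+[n∸m]≡n (⊓-glb (n≤1+n j) (bounded 1≤h)))
        affine : q r j + q r j ≡ j + q (r ∸ 1) j + q (suc r) j
        affine = begin
          q r j + q r j                    ≡⟨ cong (_+ q r j) (rising r (∸-monoʳ-< {o = 0} 1≤h h≤r) ≤-refl) ⟩
          q (r ∸ 1) j + j + q r j          ≡⟨ cong (_+ q r j) (+-comm (q (r ∸ 1) j) j) ⟩
          j + q (r ∸ 1) j + q r j          ≡⟨ cong (j + q (r ∸ 1) j +_) (sym (flat (suc r) (n≤1+n r) r<n)) ⟩
          j + q (r ∸ 1) j + q (suc r) j    ∎
          where open ≡-Reasoning

      convex-above : ∀ a → r < a → a < n → y a + y a ≤ y (a ∸ 1) + y (suc a)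
      convex-above a r<a a<n =
        convex-y {T = 0} affine (convex-off-r a j (≤-trans (s≤s z≤n) r<a) a<n (>⇒≢ r<a))
        where
        qa≡qr : q a j ≡ q r j
        qa≡qr = flat a (<⇒≤ r<a) (<⇒≤ a<n)
        affine : q a j + q a j ≡ q (a ∸ 1) j + q (suc a) j
        affine = cong₂ _+_ (trans qa≡qr (sym (flat (a ∸ 1) (<⇒≤pred r<a) (≤-trans (m∸n≤m a 1) (<⇒≤ a<n)))))
                           (trans qa≡qr (sym (flat (suc a) (≤-trans (<⇒≤ r<a) (n≤1+n a)) a<n)))

      convex-end-y : y n ≤ y (n ∸ 1)
      convex-end-y = +-cancelˡ-≤ (q r j) (y n) (y (n ∸ 1))
        (subst₂ _≤_ (trans (q-suc n) (cong (_+ y n) (flat n (<⇒≤ r<n) ≤-refl)))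
                    (trans (q-suc (n ∸ 1)) (cong (_+ y (n ∸ 1)) (flat (n ∸ 1) (<⇒≤pred r<n) (m∸n≤m n 1))))
                    (convex-end j))

      open Staircase n r h e y r<n h≤r e≤1 empty convex-below convex-r convex-above convex-end-y

      rising′ : ∀ a → r ∸ y r < a → a ≤ r → q a (suc j) ≡ q (a ∸ 1) (suc j) + suc j
      rising′ a k′<a a≤r = begin
        q a (suc j)                          ≡⟨ q-suc a ⟩
        q a j + y a                          ≡⟨ cong₂ _+_ (rising a (≤-<-trans (∸-monoʳ-≤ r height≤h) k′<a) a≤r) y≡ ⟩
        q (a ∸ 1) j + j + suc (y (a ∸ 1))    ≡⟨ swap (q (a ∸ 1) j) j (y (a ∸ 1)) ⟩
        q (a ∸ 1) j + y (a ∸ 1) + suc j      ≡⟨ cong (_+ suc j) (sym (q-suc (a ∸ 1))) ⟩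
        q (a ∸ 1) (suc j) + suc j            ∎
        where
        open ≡-Reasoning
        swap : ∀ u v w → u + v + suc w ≡ u + w + suc v
        swap = solve-∀
        y≡ : y a ≡ suc (y (a ∸ 1))
        y≡ = trans (shape-below a a≤r)
               (trans (stair-rise (y r) r a a≤r k′<a) (cong suc (sym (shape-below (a ∸ 1) (≤-trans (m∸n≤m a 1) a≤r)))))

      flat′ : ∀ a → r ≤ a → a ≤ n → q a (suc j) ≡ q r (suc j)
      flat′ a r≤a a≤n = trans (q-suc a) (trans (cong₂ _+_ (flat a r≤a a≤n) (shape-above a r≤a a≤n)) (sym (q-suc r)))

      bounded′ : 1 ≤ y r → suc j ≤ s
      bounded′ 1≤yr = ≤-trans (≰⇒> min≰j) (m⊓n≤n (suc j) s)
        where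
        min≰j : suc j ⊓ s ≤ j → ⊥
        min≰j min≤j with () ← trans (sym (slack 1≤yr)) (m≤n⇒m∸n≡0 min≤j)

      empty′ : ∀ a → a ≤ r ∸ y r → x a (suc (suc j)) ≡ 0
      empty′ a a≤r∸h′ = n≤0⇒n≡0 (≤-trans (parts≥-antitone (suc j) (ν a)) (≤-reflexive
        (trans (shape-below a (≤-trans a≤r∸h′ (m∸n≤m r (y r))))
               (m≤n⇒m∸n≡0 (m≤o∸n⇒n≤o∸m (≤-trans height≤h h≤r) a≤r∸h′)))))

      next : Level (suc j) (y r)
      next = record { h≤r = ≤-trans height≤h h≤r ; rising = rising′ ; flat = flat′ ; bounded = bounded′ ; empty = empty′ }

      shape : Shape (suc j)
      shape = record { below = shape-below ; above = shape-above }

    step : ∀ {j h} → Level j h → Level (suc j) (x r (suc j)) × Shape (suc j)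
    step L = Step.next L , Step.shape L

    levels : ∀ j → Level (suc j) (x r (suc j)) × Shape (suc j)
    levels zero    = step level-zero
    levels (suc j) = step (proj₁ (levels j))

    column-below : ∀ j a → a ≤ r → x a (suc j) ≡ x r (suc j) ∸ (r ∸ a)
    column-below j = Shape.below (proj₂ (levels j))

    column-above : ∀ j a → r ≤ a → a ≤ n → x a (suc j) ≡ x r (suc j)
    column-above j = Shape.above (proj₂ (levels j))

    column-height : ∀ j → x r (suc j) ≤ r
    column-height j = Level.h≤r (proj₁ (levels j))

module RectangleComplement where

  open import Data.Nat using (ℕ; zero; suc; _+_; _∸_; _≤_; _<_; z≤n; s≤s; _≤?_; _<?_)
  open import Data.Nat.Properties
  open import Data.List using (List; []; _∷_; _∷ʳ_; _++_; applyUpTo; map; drop; length; filter; reverse; upTo)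
  open import Data.List.Properties using (map-upTo; map-∘; map-cong; upTo-∷ʳ; map-++; reverse-++; filter-accept; filter-reject; length-filter)
  open import Data.List.Relation.Unary.All as All using (All; []; _∷_)
  open import Data.List.Relation.Unary.All.Properties using (all-filter)
  open import Data.Product using (_,_)
  open import Data.Sum using (inj₁; inj₂)
  open import Function using (_∘_)
  open import Relation.Nullary using (yes; no)
  open import Relation.Binary.PropositionalEquality
  open Partitions
  open DiscreteConvexity using (ascend; descend)

  range-suc : ∀ j n → j < n → range j n ≡ j ∷ range (suc j) n
  range-suc j (suc n) (s≤s j≤n) = begin
    map (j +_) (upTo (suc n ∸ j))                   ≡⟨ cong (map (j +_) ∘ upTo) (+-∸-assoc 1 j≤n) ⟩
    j + 0 ∷ map (j +_) (applyUpTo suc m)  ≡⟨ cong₂ _∷_ (+-identityʳ j) shift ⟩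
    j ∷ range (suc j) (suc n)                       ∎
    where
    open ≡-Reasoning
    m : ℕ
    m = n ∸ j
    shift : map (j +_) (applyUpTo suc m) ≡ map (suc j +_) (upTo m)
    shift = begin
      map (j +_) (applyUpTo suc m) ≡⟨ cong (map (j +_)) (sym (map-upTo suc m)) ⟩
      map (j +_) (map suc (upTo m))          ≡⟨ sym (map-∘ (upTo m)) ⟩
      map ((j +_) ∘ suc) (upTo m)            ≡⟨ map-cong (+-suc j) (upTo m) ⟩
      map (suc j +_) (upTo m)                ∎

  module _ (n : ℕ) (k : ℕ → ℕ) where

    row-suc : ∀ j → j < n → row n k j ≡ k j + row n k (suc j)
    row-suc j j<n = cong (sumℕ ∘ map k) (range-suc j n j<n)

    row-beyond : ∀ j → n ≤ j → row n k j ≡ 0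
    row-beyond j n≤j = cong (λ m → sumℕ (map k (map (j +_) (upTo m)))) (m≤n⇒m∸n≡0 n≤j)

    row-suc-≤ : ∀ j → row n k (suc j) ≤ row n k j
    row-suc-≤ j with j <? n
    ... | yes j<n = subst (row n k (suc j) ≤_) (sym (row-suc j j<n)) (m≤n+m _ (k j))
    ... | no  j≮n = ≤-reflexive (trans (row-beyond (suc j) (≤-trans (≮⇒≥ j≮n) (n≤1+n j)))
                                       (sym (row-beyond j (≮⇒≥ j≮n))))

    row-antitone : ∀ {i j} → i ≤ j → row n k j ≤ row n k i
    row-antitone {i} {j} i≤j =
      ascend {P = λ a → row n k a ≤ row n k i} ≤-refl (λ a _ _ ih → ≤-trans (row-suc-≤ a) ih) j i≤j ≤-refl

    row≡0⇒k≡0 : ∀ j b → row n k j ≡ 0 → j ≤ b → b < n → k b ≡ 0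
    row≡0⇒k≡0 j b row≡0 j≤b b<n =
      m+n≡0⇒m≡0 (k b) (trans (sym (row-suc b b<n)) (n≤0⇒n≡0 (subst (row n k b ≤_) row≡0 (row-antitone j≤b))))

    k≡0⇒row≡0 : ∀ j → (∀ b → j ≤ b → b < n → k b ≡ 0) → row n k j ≡ 0
    k≡0⇒row≡0 j k≡0 with j ≤? n
    ... | no  j≰n = row-beyond j (<⇒≤ (≰⇒> j≰n))
    ... | yes j≤n = descend {P = λ a → row n k a ≡ 0} (row-beyond n ≤-refl)
                      (λ a j≤a a<n ih → trans (row-suc a a<n) (cong₂ _+_ (k≡0 a j≤a a<n) ih)) j ≤-refl j≤n

  positives : List ℕ → List ℕ
  positives = filter (1 ≤?_)

  entries-≤0 : ∀ {μ} → All (_≤ 0) μ → ∀ d → largest (drop d μ) ≡ 0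
  entries-≤0 []          zero    = refl
  entries-≤0 []          (suc d) = refl
  entries-≤0 (x≤0 ∷ _)   zero    = n≤0⇒n≡0 x≤0
  entries-≤0 (_ ∷ μ≤0)   (suc d) = entries-≤0 μ≤0 d

  positives-none : ∀ {μ} → All (_≤ 0) μ → positives μ ≡ []
  positives-none []         = refl
  positives-none (x≤0 ∷ μ≤0) = trans (filter-reject (1 ≤?_) (λ 1≤x → <-irrefl refl (≤-trans 1≤x x≤0))) (positives-none μ≤0)

  Decreasing-≤0 : ∀ {x μ} → Decreasing (x ∷ μ) → x ≤ 0 → All (_≤ 0) (x ∷ μ)
  Decreasing-≤0 d x≤0 = x≤0 ∷ All.map (λ y≤x → ≤-trans y≤x x≤0) (Decreasing-bounded d)

  positives-entries : ∀ {μ} → Decreasing μ → ∀ d → largest (drop d (positives μ)) ≡ largest (drop d μ)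
  positives-entries []              d = refl
  positives-entries {x ∷ μ} dec d with 1 ≤? x
  ... | yes 1≤x = trans (cong (λ ν → largest (drop d ν)) (filter-accept (1 ≤?_) 1≤x)) (cons d)
    where
    cons : ∀ d → largest (drop d (x ∷ positives μ)) ≡ largest (drop d (x ∷ μ))
    cons zero    = refl
    cons (suc d) = positives-entries (Decreasing-tail dec) d
  ... | no  1≰x = trans (cong (λ ν → largest (drop d ν)) (positives-none (Decreasing-≤0 dec x≤0)))
                        (trans (entries-≤0 [] d) (sym (entries-≤0 (Decreasing-≤0 dec x≤0) d)))
    where
    x≤0 : x ≤ 0
    x≤0 = ≤-pred (≰⇒> 1≰x)

  positives-decreasing : ∀ {μ} → Decreasing μ → Decreasing (positives μ)
  positives-decreasing []              = []
  positives-decreasing {x ∷ μ} dec with 1 ≤? x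
  ... | yes 1≤x = subst Decreasing (sym (filter-accept (1 ≤?_) 1≤x))
                    (Decreasing-cons (positives-decreasing (Decreasing-tail dec))
                       (≤-trans (≤-reflexive (positives-entries (Decreasing-tail dec) 0)) (largest-drop-antitone dec 0)))
  ... | no  1≰x = subst Decreasing (sym (positives-none (Decreasing-≤0 dec (≤-pred (≰⇒> 1≰x))))) []

  module Complement (n r s : ℕ) (k : ℕ → ℕ) where

    padded : ℕ → List ℕ
    padded m = map (λ j → s ∸ row n k j) (reverse (oneTo m))

    padded-suc : ∀ m → padded (suc m) ≡ s ∸ row n k (suc m) ∷ padded m
    padded-suc m = cong (map (λ j → s ∸ row n k j)) (begin
      reverse (map suc (upTo (suc m)))          ≡⟨ cong (reverse ∘ map suc) (sym (upTo-∷ʳ m)) ⟩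
      reverse (map suc (upTo m ∷ʳ m))           ≡⟨ cong reverse (map-++ suc (upTo m) (m ∷ [])) ⟩
      reverse (oneTo m ++ suc m ∷ []) ≡⟨ reverse-++ (oneTo m) (suc m ∷ []) ⟩
      suc m ∷ reverse (oneTo m)                 ∎)
      where open ≡-Reasoning

    padded-decreasing : ∀ m → Decreasing (padded m)
    padded-decreasing zero    = []
    padded-decreasing (suc m) = subst Decreasing (sym (padded-suc m)) (Decreasing-cons (padded-decreasing m) (head≤ m))
      where
      head≤ : ∀ m → largest (padded m) ≤ s ∸ row n k (suc m)
      head≤ zero    = z≤n
      head≤ (suc m) = subst (λ μ → largest μ ≤ s ∸ row n k (suc (suc m))) (sym (padded-suc m))
                        (∸-monoʳ-≤ s (row-suc-≤ n k (suc m)))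

    padded-length : ∀ m → length (padded m) ≡ m
    padded-length zero    = refl
    padded-length (suc m) = trans (cong length (padded-suc m)) (cong suc (padded-length m))

    padded-entry : ∀ m a → 1 ≤ a → a ≤ m → largest (drop (m ∸ a) (padded m)) ≡ s ∸ row n k a
    padded-entry zero    a 1≤a a≤0 with () ← ≤-trans 1≤a a≤0
    padded-entry (suc m) a 1≤a a≤1+m with m≤n⇒m<n∨m≡n a≤1+m
    ... | inj₂ refl = trans (cong (λ d → largest (drop d (padded (suc m)))) (n∸n≡0 m))
                            (cong largest (padded-suc m))
    ... | inj₁ (s≤s a≤m) = begin
      largest (drop (suc m ∸ a) (padded (suc m)))          ≡⟨ cong (λ d → largest (drop d (padded (suc m)))) (+-∸-assoc 1 a≤m) ⟩
      largest (drop (suc (m ∸ a)) (padded (suc m)))        ≡⟨ cong (largest ∘ drop (suc (m ∸ a))) (padded-suc m) ⟩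
      largest (drop (m ∸ a) (padded m))                    ≡⟨ padded-entry m a 1≤a a≤m ⟩
      s ∸ row n k a                                        ∎
      where open ≡-Reasoning

    complement-partition : IsPartition (complement n r s k)
    complement-partition = positives-decreasing (padded-decreasing r) , all-filter (1 ≤?_) (padded r)

    complement-length : length (complement n r s k) ≤ r
    complement-length = ≤-trans (length-filter (1 ≤?_) (padded r)) (≤-reflexive (padded-length r))

    complement-entry : ∀ a → 1 ≤ a → a ≤ r → largest (drop (r ∸ a) (complement n r s k)) ≡ s ∸ row n k a
    complement-entry a 1≤a a≤r = trans (positives-entries (padded-decreasing r) (r ∸ a)) (padded-entry r a 1≤a a≤r)

module StaircaseConfigurations where

  open import Data.Nat as ℕ using (ℕ; suc; _∸_; _≤_; _<_; _⊓_; z≤n; s≤s)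
  import Data.Nat.Properties as ℕ
  open import Data.Integer as ℤ using (ℤ; +_; _+_; _-_)
  import Data.Integer.Properties as ℤ
  open import Data.Integer.Tactic.RingSolver using (solve-∀)
  open import Data.List using (List; []; _∷_; map; drop; length)
  open import Data.List.Properties using (filter-accept; filter-reject; drop-all)
  open import Data.Product using (Σ; _×_; _,_; proj₁; proj₂)
  open import Data.Sum using (inj₁; inj₂)
  open import Relation.Binary.PropositionalEquality
  open import Relation.Binary.Definitions using (tri<; tri≈; tri>)
  open IntegralVacancy using (cartanSum; vacancy)
  open CartanRowSums
  open Partitions

  ⊓-saturate : ∀ {i x y} → x ℕ.≤ y → i ℕ.≤ x → i ⊓ x ≡ i ⊓ y
  ⊓-saturate x≤y i≤x = trans (ℕ.m≤n⇒m⊓n≡m i≤x) (sym (ℕ.m≤n⇒m⊓n≡m (ℕ.≤-trans i≤x x≤y)))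

  module SecondDifference (n r : ℕ) (1≤r : 1 ≤ r) (r<n : r < n) (G Δ : ℕ → ℤ)
    (G0≡0  : G 0 ≡ + 0)
    (G-suc : ∀ a → 1 ≤ a → a ≤ r → G a ≡ Δ a + G (a ∸ 1))
    (G-top : ∀ a → r ≤ a → G a ≡ G r) where

    cartanSum-below : ∀ b → 1 ≤ b → b < r → cartanSum n b G ≡ Δ b - Δ (suc b)
    cartanSum-below b 1≤b b<r = begin
      cartanSum n b G
        ≡⟨ cartanSum-inner n b G 1≤b (ℕ.<-trans b<r r<n) G0≡0 ⟩
      (G b + G b) - G (b ∸ 1) - G (suc b)
        ≡⟨ cong₂ (λ u v → (u + u) - G (b ∸ 1) - v) Gb (trans (G-suc (suc b) (s≤s z≤n) b<r) (cong (_+_ (Δ (suc b))) Gb)) ⟩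
      ((Δ b + G (b ∸ 1)) + (Δ b + G (b ∸ 1))) - G (b ∸ 1) - (Δ (suc b) + (Δ b + G (b ∸ 1)))
        ≡⟨ telescope (Δ b) (Δ (suc b)) (G (b ∸ 1)) ⟩
      Δ b - Δ (suc b) ∎
      where
      open ≡-Reasoning
      Gb : G b ≡ Δ b + G (b ∸ 1)
      Gb = G-suc b 1≤b (ℕ.<⇒≤ b<r)
      telescope : ∀ d d′ p → ((d + p) + (d + p)) - p - (d′ + (d + p)) ≡ d - d′
      telescope = solve-∀

    cartanSum-at : cartanSum n r G ≡ Δ r
    cartanSum-at = begin
      cartanSum n r G
        ≡⟨ cartanSum-inner n r G 1≤r r<n G0≡0 ⟩
      (G r + G r) - G (r ∸ 1) - G (suc r)
        ≡⟨ cong₂ (λ u v → (u + u) - G (r ∸ 1) - v) Gr (trans (G-top (suc r) (ℕ.n≤1+n r)) Gr) ⟩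
      ((Δ r + G (r ∸ 1)) + (Δ r + G (r ∸ 1))) - G (r ∸ 1) - (Δ r + G (r ∸ 1))
        ≡⟨ peak (Δ r) (G (r ∸ 1)) ⟩
      Δ r ∎
      where
      open ≡-Reasoning
      Gr : G r ≡ Δ r + G (r ∸ 1)
      Gr = G-suc r 1≤r ℕ.≤-refl
      peak : ∀ d p → ((d + p) + (d + p)) - p - (d + p) ≡ d
      peak = solve-∀

    cartanSum-above : ∀ b → r < b → b ≤ n → cartanSum n b G ≡ + 0
    cartanSum-above b r<b b≤n with ℕ.m≤n⇒m<n∨m≡n b≤n
    ... | inj₁ b<n = begin
      cartanSum n b G
        ≡⟨ cartanSum-inner n b G (ℕ.≤-trans 1≤r (ℕ.<⇒≤ r<b)) b<n G0≡0 ⟩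
      (G b + G b) - G (b ∸ 1) - G (suc b)
        ≡⟨ cong₂ (λ u v → u - v) (cong₂ (λ u v → (u + u) - v) (G-top b (ℕ.<⇒≤ r<b)) (G-top (b ∸ 1) (ℕ.<⇒≤pred r<b)))
                                  (G-top (suc b) (ℕ.≤-trans (ℕ.<⇒≤ r<b) (ℕ.n≤1+n b))) ⟩
      (G r + G r) - G r - G r
        ≡⟨ flat (G r) ⟩
      + 0 ∎
      where
      open ≡-Reasoning
      flat : ∀ g → (g + g) - g - g ≡ + 0
      flat = solve-∀
    ... | inj₂ refl = begin
      cartanSum b b G
        ≡⟨ cartanSum-last b G (ℕ.≤-trans (s≤s 1≤r) r<b) ⟩
      (G b + G b) - (G (b ∸ 1) + G (b ∸ 1))
        ≡⟨ cong₂ (λ u v → (u + u) - (v + v)) (G-top b (ℕ.<⇒≤ r<b)) (G-top (b ∸ 1) (ℕ.<⇒≤pred r<b)) ⟩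
      (G r + G r) - (G r + G r)
        ≡⟨ flat (G r) ⟩
      + 0 ∎
      where
      open ≡-Reasoning
      flat : ∀ g → (g + g) - (g + g) ≡ + 0
      flat = solve-∀

  module SingleEntry (r s : ℕ) where

    L : MultArray
    L = (r , s) ∷ []

    entriesAt-at : entriesAt L r ≡ s ∷ []
    entriesAt-at = cong (map proj₂) (filter-accept (λ e → proj₁ e ℕ.≟ r) refl)

    entriesAt-off : ∀ a → a ≢ r → entriesAt L a ≡ []
    entriesAt-off a a≢r = cong (map proj₂) (filter-reject (λ e → proj₁ e ℕ.≟ a) (λ r≡a → a≢r (sym r≡a)))

    Lmin-at : ∀ i → Lmin L r i ≡ i ⊓ s
    Lmin-at i = trans (cong (λ js → sumℕ (map (i ⊓_) js)) entriesAt-at) (ℕ.+-identityʳ (i ⊓ s))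

    Lmin-off : ∀ a i → a ≢ r → Lmin L a i ≡ 0
    Lmin-off a i a≢r = cong (λ js → sumℕ (map (i ⊓_) js)) (entriesAt-off a a≢r)

    Lsize-at : Lsize L r ≡ s
    Lsize-at = trans (cong sumℕ entriesAt-at) (ℕ.+-identityʳ s)

    Lsize-off : ∀ a → a ≢ r → Lsize L a ≡ 0
    Lsize-off a a≢r = cong sumℕ (entriesAt-off a a≢r)

  module Stair (n r : ℕ) (1≤r : 1 ≤ r) (r<n : r < n) (μ : List ℕ) (ℓμ≤r : length μ ≤ r) where

    stair : ℕ → List ℕ
    stair a = drop (r ∸ a) μ

    stair-suc : ∀ a → 1 ≤ a → a ≤ r → r ∸ (a ∸ 1) ≡ suc (r ∸ a)
    stair-suc (suc a) _ a<r = ℕ.+-∸-assoc 1 a<r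

    module StairSum (ψ : ℕ → ℕ) (ψ0≡0 : ψ 0 ≡ 0) = SecondDifference n r 1≤r r<n
      (λ a → + sumℕ (map ψ (stair a))) (λ a → + ψ (largest (stair a)))
      (cong (λ ν → + sumℕ (map ψ ν)) (drop-all r μ ℓμ≤r))
      (λ a 1≤a a≤r → trans (cong +_ (sum-map-drop ψ ψ0≡0 (r ∸ a) μ))
                           (cong (λ m → + ψ (largest (stair a)) + + sumℕ (map ψ (drop m μ))) (sym (stair-suc a 1≤a a≤r))))
      (λ a r≤a → cong (λ m → + sumℕ (map ψ (drop m μ))) (trans (ℕ.m≤n⇒m∸n≡0 r≤a) (sym (ℕ.n∸n≡0 r))))

    largest-stair-monotone : Decreasing μ → ∀ a → a < r → largest (stair a) ℕ.≤ largest (stair (suc a))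
    largest-stair-monotone μ-dec a a<r =
      subst (λ m → largest (drop m μ) ℕ.≤ largest (stair (suc a))) (sym (ℕ.+-∸-assoc 1 a<r))
            (largest-drop-antitone μ-dec (r ∸ suc a))

    module StairVacancy (s : ℕ) (μ-dec : Decreasing μ) (μ≤s : largest μ ℕ.≤ s) where
      open SingleEntry r s

      vacancy-gap : ∀ a i → 1 ≤ a → a ≤ n →
        Σ ℕ λ x → Σ ℕ λ y → x ℕ.≤ y × (i ℕ.≤ largest (stair a) → x ≡ y) × vacancy n L stair a i ≡ + y - + x
      vacancy-gap a i 1≤a a≤n with ℕ.<-cmp a r
      ... | tri< a<r _ _ = i ⊓ largest (stair a) , i ⊓ largest (stair (suc a)) ,
            ℕ.⊓-monoʳ-≤ i (largest-stair-monotone μ-dec a a<r) , ⊓-saturate (largest-stair-monotone μ-dec a a<r) ,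
            trans (cong₂ _-_ (cong +_ (Lmin-off a i (ℕ.<⇒≢ a<r))) (cartanSum-below a 1≤a a<r)) (flip (+ (i ⊓ largest (stair a))) (+ (i ⊓ largest (stair (suc a)))))
        where
        open StairSum (i ⊓_) (ℕ.⊓-zeroʳ i)
        flip : ∀ u v → + 0 - (u - v) ≡ v - u
        flip = solve-∀
      ... | tri≈ _ refl _ = i ⊓ largest μ , i ⊓ s , ℕ.⊓-monoʳ-≤ i μ≤s , saturate-at-r ,
            cong₂ _-_ (cong +_ (Lmin-at i)) (trans cartanSum-at (cong (λ m → + (i ⊓ largest (drop m μ))) (ℕ.n∸n≡0 a)))
        where
        open StairSum (i ⊓_) (ℕ.⊓-zeroʳ i)
        saturate-at-r : i ℕ.≤ largest (stair a) → i ⊓ largest μ ≡ i ⊓ s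
        saturate-at-r i≤ = ⊓-saturate μ≤s (subst (λ m → i ℕ.≤ largest (drop m μ)) (ℕ.n∸n≡0 a) i≤)
      ... | tri> _ _ r<a = 0 , 0 , z≤n , (λ _ → refl) ,
            cong₂ _-_ (cong +_ (Lmin-off a i (ℕ.>⇒≢ r<a))) (cartanSum-above a r<a a≤n)
        where open StairSum (i ⊓_) (ℕ.⊓-zeroʳ i)

      stair-vacancy-nonneg : ∀ a i → 1 ≤ a → a ≤ n → + 0 ℤ.≤ vacancy n L stair a i
      stair-vacancy-nonneg a i 1≤a a≤n with vacancy-gap a i 1≤a a≤n
      ... | x , y , x≤y , _ , eq = subst (+ 0 ℤ.≤_) (sym eq) (ℤ.i≤j⇒0≤j-i (ℤ.+≤+ x≤y))

      stair-vacancy-zero : ∀ a i → 1 ≤ a → a ≤ n → i ℕ.≤ largest (stair a) → vacancy n L stair a i ≡ + 0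
      stair-vacancy-zero a i 1≤a a≤n i≤ with vacancy-gap a i 1≤a a≤n
      ... | x , y , _ , x≡y , eq = trans eq (trans (cong (λ z → + y - + z) (x≡y i≤)) (ℤ.+-inverseʳ (+ y)))

module HighestWeight where

  open import Data.Bool using (true; false; T)
  open import Data.Nat as ℕ using (ℕ; zero; suc; _∸_; _≤_; _<_; _⊓_; z≤n; s≤s; _≤?_)
  import Data.Nat.Properties as ℕ
  open import Data.Integer as ℤ using (+_; _+_; _-_)
  import Data.Integer.Properties as ℤ
  open import Data.Integer.Tactic.RingSolver using (solve-∀)
  open import Data.Rational as ℚ using (0ℚ)
  open import Data.List using (List; []; _∷_; map; drop; length)
  open import Data.List.Properties using (map-id)
  open import Data.List.Relation.Unary.All as All using (All; []; _∷_)
  open import Data.List.Relation.Binary.Pointwise using (Pointwise; []; _∷_)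
  open import Data.Product using (_×_; _,_; proj₁; proj₂; ∃₂)
  open import Data.Sum using (inj₁; inj₂)
  open import Function using (id)
  open import Relation.Nullary using (yes; no)
  open import Relation.Binary.PropositionalEquality
  open import Relation.Binary.Definitions using (tri<; tri≈; tri>)
  open IntegralVacancy
  open CartanRowSums
  open Partitions
  open DiscreteConvexity using (descend)
  open Columns
  open RectangleComplement
  open StaircaseConfigurations

  second-difference-nonneg : ∀ ℓ a b c → + 0 ℤ.≤ + ℓ - ((+ a + + a) - + b - + c) → a ℕ.+ a ≤ ℓ ℕ.+ b ℕ.+ c
  second-difference-nonneg ℓ a b c 0≤ =
    ℤ.drop‿+≤+ (ℤ.0≤i-j⇒j≤i (subst (+ 0 ℤ.≤_) (rearrange (+ ℓ) (+ a) (+ b) (+ c)) 0≤))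
    where
    rearrange : ∀ ℓ a b c → ℓ - ((a + a) - b - c) ≡ (ℓ + b + c) - (a + a)
    rearrange = solve-∀

  end-difference-nonneg : ∀ a b → + 0 ℤ.≤ + 0 - ((+ a + + a) - (+ b + + b)) → a ≤ b
  end-difference-nonneg a b 0≤ = ℕ.≮⇒≥ (λ b<a → ℕ.<⇒≱ (ℕ.+-mono-< b<a b<a) 2a≤2b)
    where
    rearrange : ∀ a b → + 0 - ((a + a) - (b + b)) ≡ (b + b) - (a + a)
    rearrange = solve-∀
    2a≤2b : a ℕ.+ a ≤ b ℕ.+ b
    2a≤2b = ℤ.drop‿+≤+ (ℤ.0≤i-j⇒j≤i (subst (+ 0 ℤ.≤_) (rearrange (+ a) (+ b)) 0≤))

  x≡y-z⇔x+z≡y : ∀ x y z → (+ x ≡ + y - + z → x ℕ.+ z ≡ y) × (x ℕ.+ z ≡ y → + x ≡ + y - + z)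
  x≡y-z⇔x+z≡y x y z = (λ eq → ℤ.+-injective (trans (cong (_+ + z) eq) (cancel (+ y) (+ z))))
              , (λ eq → trans (sym (cancel′ (+ x) (+ z))) (cong (λ m → + m - + z) eq))
    where
    cancel : ∀ y z → (y - z) + z ≡ y
    cancel = solve-∀
    cancel′ : ∀ x z → (x + z) - z ≡ x
    cancel′ = solve-∀

  x-y≡-z⇔x+z≡y : ∀ x y z → (+ x - + y ≡ + 0 - + z → x ℕ.+ z ≡ y) × (x ℕ.+ z ≡ y → + x - + y ≡ + 0 - + z)
  x-y≡-z⇔x+z≡y x y z = (λ eq → ℤ.+-injective (trans (sym (shift (+ x) (+ y) (+ z))) (trans (cong (λ d → d + + y + + z) eq) (cancel (+ y) (+ z)))))
               , (λ eq → trans (cong (λ m → + x - + m) (sym eq)) (cancel′ (+ x) (+ z)))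
    where
    shift : ∀ x y z → (x - y) + y + z ≡ x + z
    shift = solve-∀
    cancel : ∀ y z → (+ 0 - z) + y + z ≡ y
    cancel = solve-∀
    cancel′ : ∀ x z → x - (x + z) ≡ + 0 - z
    cancel′ = solve-∀

  νλ≡complement-stair : ∀ n r s k a → νλ n r s k a ≡ drop (r ∸ a) (complement n r s k)
  νλ≡complement-stair n r s k a with a ℕ.<ᵇ r in a<ᵇr
  ... | true  = refl
  ... | false = cong (λ m → drop m (complement n r s k))
                     (sym (ℕ.m≤n⇒m∸n≡0 {r} {a} (ℕ.≮⇒≥ (λ a<r → subst T a<ᵇr (ℕ.<⇒<ᵇ a<r)))))

  zeroLabels-fit : ∀ μ (p : ℕ → ℚ.ℚ) → (∀ j → 0ℚ ℚ.≤ p j) → Pointwise (λ j l → nat→ℚ l ℚ.≤ p j) μ (zeroLabels μ)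
  zeroLabels-fit []      p p≥0 = []
  zeroLabels-fit (j ∷ μ) p p≥0 = p≥0 j ∷ zeroLabels-fit μ p p≥0

  labels-under-zero : ∀ {μ J} (p : ℕ → ℚ.ℚ) → Pointwise (λ j l → nat→ℚ l ℚ.≤ p j) μ J →
    All (λ j → p j ≡ 0ℚ) μ → J ≡ zeroLabels μ
  labels-under-zero p []               []              = refl
  labels-under-zero p (l≤pj ∷ J≤p) (pj≡0 ∷ p≡0) =
    cong₂ _∷_ (ℕ.n≤0⇒n≡0 (ℤ.drop‿+≤+ (ℤ→ℚ-cancel-≤ (subst (_ ℚ.≤_) pj≡0 l≤pj)))) (labels-under-zero p J≤p p≡0)

  module _ (n r s : ℕ) (k : ℕ → ℕ) (1≤r : 1 ≤ r) (r<n : r < n) where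
    open SingleEntry r s

    module FromRiggedConfiguration {ν J} (rc : hwRC n L k ν J) where

      partitions : ∀ a → 1 ≤ a → a ≤ n → IsPartition (ν a)
      partitions = proj₁ rc

      configuration : IsConfig n L k ν
      configuration = proj₁ (proj₂ rc)

      vac-nonneg : ∀ a i → 1 ≤ a → a ≤ n → 1 ≤ i → 0ℚ ℚ.≤ vac n L ν a i
      vac-nonneg = proj₁ (proj₂ (proj₂ rc))

      -- hwRC does not constrain ν 0, while the Cartan row sums need ν^{(0)} = ∅
      ν′ : ℕ → List ℕ
      ν′ zero    = []
      ν′ (suc a) = ν (suc a)

      ν′≡ν : ∀ a → 1 ≤ a → ν′ a ≡ ν a
      ν′≡ν (suc a) _ = refl

      vacancy-nonneg : ∀ a j → 1 ≤ a → a ≤ n → + 0 ℤ.≤ vacancy n L ν′ a (suc j)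
      vacancy-nonneg a j 1≤a a≤n = subst (+ 0 ℤ.≤_) ν≡ν′
        (ℤ→ℚ-cancel-≤ (subst (0ℚ ℚ.≤_) (vac≡vacancy n L ν a (suc j)) (vac-nonneg a (suc j) 1≤a a≤n (s≤s z≤n))))
        where
        ν≡ν′ : vacancy n L ν a (suc j) ≡ vacancy n L ν′ a (suc j)
        ν≡ν′ = cong (ℤ._-_ (+ Lmin L a (suc j)))
                    (cartanSum-cong n a _ _ (λ b 1≤b _ → cong (λ μ → + Q (suc j) μ) (sym (ν′≡ν b 1≤b))))

      q : ℕ → ℕ → ℕ
      q a j = Q j (ν′ a)

      convex-off-r : ∀ a j → 1 ≤ a → a < n → a ≢ r → q a (suc j) ℕ.+ q a (suc j) ≤ q (a ∸ 1) (suc j) ℕ.+ q (suc a) (suc j)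
      convex-off-r a j 1≤a a<n a≢r = second-difference-nonneg 0 (q a (suc j)) (q (a ∸ 1) (suc j)) (q (suc a) (suc j)) (subst (+ 0 ℤ.≤_)
        (cong₂ _-_ (cong +_ (Lmin-off a (suc j) a≢r)) (cartanSum-inner n a (λ b → + q b (suc j)) 1≤a a<n refl))
        (vacancy-nonneg a j 1≤a (ℕ.<⇒≤ a<n)))

      convex-at-r : ∀ j → q r (suc j) ℕ.+ q r (suc j) ≤ (suc j ⊓ s) ℕ.+ q (r ∸ 1) (suc j) ℕ.+ q (suc r) (suc j)
      convex-at-r j = second-difference-nonneg (suc j ⊓ s) (q r (suc j)) (q (r ∸ 1) (suc j)) (q (suc r) (suc j)) (subst (+ 0 ℤ.≤_)
        (cong₂ _-_ (cong +_ (Lmin-at (suc j))) (cartanSum-inner n r (λ b → + q b (suc j)) 1≤r r<n refl))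
        (vacancy-nonneg r j 1≤r (ℕ.<⇒≤ r<n)))

      convex-end : ∀ j → q n (suc j) ≤ q (n ∸ 1) (suc j)
      convex-end j = end-difference-nonneg (q n (suc j)) (q (n ∸ 1) (suc j)) (subst (+ 0 ℤ.≤_)
        (cong₂ _-_ (cong +_ (Lmin-off n (suc j) (ℕ.>⇒≢ r<n))) (cartanSum-last n (λ b → + q b (suc j)) (ℕ.≤-trans (s≤s 1≤r) r<n)))
        (vacancy-nonneg n j (ℕ.≤-trans 1≤r (ℕ.<⇒≤ r<n)) ℕ.≤-refl))

      open ColumnInduction n r s ν′ refl r<n convex-off-r convex-at-r convex-end
        using (column-below; column-above; column-height)

      μ : List ℕ
      μ = ν r

      μ-partition : IsPartition μ
      μ-partition = partitions r 1≤r (ℕ.<⇒≤ r<n)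

      μ-length : length μ ≤ r
      μ-length = subst (_≤ r) (trans (cong (parts≥ 1) (ν′≡ν r 1≤r)) (parts≥-positive (proj₂ μ-partition))) (column-height 0)

      ν-stair : ∀ a → 1 ≤ a → a ≤ n → ν a ≡ drop (r ∸ a) μ
      ν-stair a 1≤a a≤n with a ≤? r
      ... | yes a≤r = partition-ext (partitions a 1≤a a≤n) (IsPartition-drop (r ∸ a) μ-partition) (λ j → begin
        parts≥ (suc j) (ν a)                  ≡⟨ cong (parts≥ (suc j)) (sym (ν′≡ν a 1≤a)) ⟩
        parts≥ (suc j) (ν′ a)                 ≡⟨ column-below j a a≤r ⟩
        parts≥ (suc j) (ν′ r) ∸ (r ∸ a)       ≡⟨ cong (λ ν → parts≥ (suc j) ν ∸ (r ∸ a)) (ν′≡ν r 1≤r) ⟩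
        parts≥ (suc j) μ ∸ (r ∸ a)            ≡⟨ sym (parts≥-drop (proj₁ μ-partition) (r ∸ a) (suc j)) ⟩
        parts≥ (suc j) (drop (r ∸ a) μ)       ∎)
        where open ≡-Reasoning
      ... | no  a≰r = trans (partition-ext (partitions a 1≤a a≤n) μ-partition (λ j → begin
        parts≥ (suc j) (ν a)                  ≡⟨ cong (parts≥ (suc j)) (sym (ν′≡ν a 1≤a)) ⟩
        parts≥ (suc j) (ν′ a)                 ≡⟨ column-above j a r≤a a≤n ⟩
        parts≥ (suc j) (ν′ r)                 ≡⟨ cong (parts≥ (suc j)) (ν′≡ν r 1≤r) ⟩
        parts≥ (suc j) μ                      ∎))
          (cong (λ m → drop m μ) (sym (ℕ.m≤n⇒m∸n≡0 r≤a)))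
        where
        open ≡-Reasoning
        r≤a : r ≤ a
        r≤a = ℕ.<⇒≤ (ℕ.≰⇒> a≰r)

      open Stair n r 1≤r r<n μ μ-length
      open StairSum id refl

      Δ : ℕ → ℕ
      Δ a = largest (stair a)

      configuration-stair : ∀ b → 1 ≤ b → b ≤ n → cartanSum n b (λ a → + sumℕ (map id (stair a))) ≡ + Lsize L b - + k b
      configuration-stair b 1≤b b≤n = trans
        (cartanSum-cong n b _ _ (λ a 1≤a a≤n → cong (λ ν → + sumℕ ν) (trans (map-id (stair a)) (sym (ν-stair a 1≤a a≤n)))))
        (configuration b 1≤b b≤n)

      k-above : ∀ b → r < b → b < n → k b ≡ 0
      k-above b r<b b<n = proj₁ (x≡y-z⇔x+z≡y 0 0 (k b)) (begin
        + 0                    ≡⟨ sym (cartanSum-above b r<b (ℕ.<⇒≤ b<n)) ⟩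
        _                      ≡⟨ configuration-stair b (ℕ.≤-trans 1≤r (ℕ.<⇒≤ r<b)) (ℕ.<⇒≤ b<n) ⟩
        + Lsize L b - + k b    ≡⟨ cong (λ m → + m - + k b) (Lsize-off b (ℕ.>⇒≢ r<b)) ⟩
        + 0 - + k b            ∎)
        where open ≡-Reasoning

      Δ-top : Δ r ℕ.+ k r ≡ s
      Δ-top = proj₁ (x≡y-z⇔x+z≡y (Δ r) s (k r)) (begin
        + Δ r                  ≡⟨ sym cartanSum-at ⟩
        _                      ≡⟨ configuration-stair r 1≤r (ℕ.<⇒≤ r<n) ⟩
        + Lsize L r - + k r    ≡⟨ cong (λ m → + m - + k r) Lsize-at ⟩
        + s - + k r            ∎)
        where open ≡-Reasoning

      Δ-rise : ∀ b → 1 ≤ b → b < r → Δ b ℕ.+ k b ≡ Δ (suc b)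
      Δ-rise b 1≤b b<r = proj₁ (x-y≡-z⇔x+z≡y (Δ b) (Δ (suc b)) (k b)) (begin
        + Δ b - + Δ (suc b)    ≡⟨ sym (cartanSum-below b 1≤b b<r) ⟩
        _                      ≡⟨ configuration-stair b 1≤b (ℕ.<⇒≤ (ℕ.<-trans b<r r<n)) ⟩
        + Lsize L b - + k b    ≡⟨ cong (λ m → + m - + k b) (Lsize-off b (ℕ.<⇒≢ b<r)) ⟩
        + 0 - + k b            ∎)
        where open ≡-Reasoning

      row-beyond-r : row n k (suc r) ≡ 0
      row-beyond-r = k≡0⇒row≡0 n k (suc r) k-above

      Δ+row : ∀ a → 1 ≤ a → a ≤ r → Δ a ℕ.+ row n k a ≡ s
      Δ+row = descend {P = λ a → Δ a ℕ.+ row n k a ≡ s} top step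
        where
        top : Δ r ℕ.+ row n k r ≡ s
        top = begin
          Δ r ℕ.+ row n k r                  ≡⟨ cong (Δ r ℕ.+_) (row-suc n k r r<n) ⟩
          Δ r ℕ.+ (k r ℕ.+ row n k (suc r))  ≡⟨ cong (λ m → Δ r ℕ.+ (k r ℕ.+ m)) row-beyond-r ⟩
          Δ r ℕ.+ (k r ℕ.+ 0)                ≡⟨ cong (Δ r ℕ.+_) (ℕ.+-identityʳ (k r)) ⟩
          Δ r ℕ.+ k r                        ≡⟨ Δ-top ⟩
          s                                  ∎
          where open ≡-Reasoning
        step : ∀ a → 1 ≤ a → a < r → Δ (suc a) ℕ.+ row n k (suc a) ≡ s → Δ a ℕ.+ row n k a ≡ s
        step a 1≤a a<r ih = begin
          Δ a ℕ.+ row n k a                  ≡⟨ cong (Δ a ℕ.+_) (row-suc n k a (ℕ.<-trans a<r r<n)) ⟩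
          Δ a ℕ.+ (k a ℕ.+ row n k (suc a))  ≡⟨ sym (ℕ.+-assoc (Δ a) (k a) _) ⟩
          Δ a ℕ.+ k a ℕ.+ row n k (suc a)    ≡⟨ cong (ℕ._+ row n k (suc a)) (Δ-rise a 1≤a a<r) ⟩
          Δ (suc a) ℕ.+ row n k (suc a)      ≡⟨ ih ⟩
          s                                  ∎
          where open ≡-Reasoning

      in-rect : InRect n r s k
      in-rect = subst (row n k 1 ≤_) (Δ+row 1 ℕ.≤-refl 1≤r) (ℕ.m≤n+m (row n k 1) (Δ 1)) , row-beyond-r

      μ≡complement : μ ≡ complement n r s k
      μ≡complement = entries-ext r (proj₂ μ-partition) (proj₂ complement-partition) μ-length complement-length entry
        where
        open Complement n r s k
        entry : ∀ d → d < r → largest (drop d μ) ≡ largest (drop d (complement n r s k))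
        entry d d<r = begin
          largest (drop d μ)                          ≡⟨ cong (λ m → largest (drop m μ)) (sym r∸[r∸d]≡d) ⟩
          Δ (r ∸ d)                                   ≡⟨ sym (ℕ.m+n∸n≡m (Δ (r ∸ d)) (row n k (r ∸ d))) ⟩
          Δ (r ∸ d) ℕ.+ row n k (r ∸ d) ∸ row n k (r ∸ d) ≡⟨ cong (_∸ row n k (r ∸ d)) (Δ+row (r ∸ d) 1≤r∸d (ℕ.m∸n≤m r d)) ⟩
          s ∸ row n k (r ∸ d)                         ≡⟨ sym (complement-entry (r ∸ d) 1≤r∸d (ℕ.m∸n≤m r d)) ⟩
          largest (drop (r ∸ (r ∸ d)) (complement n r s k)) ≡⟨ cong (λ m → largest (drop m (complement n r s k))) r∸[r∸d]≡d ⟩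
          largest (drop d (complement n r s k))       ∎
          where
          open ≡-Reasoning
          r∸[r∸d]≡d : r ∸ (r ∸ d) ≡ d
          r∸[r∸d]≡d = ℕ.m∸[m∸n]≡n (ℕ.<⇒≤ d<r)
          1≤r∸d : 1 ≤ r ∸ d
          1≤r∸d = ℕ.m<n⇒0<n∸m d<r

      ν≡νλ : ∀ a → 1 ≤ a → a ≤ n → ν a ≡ νλ n r s k a
      ν≡νλ a 1≤a a≤n = trans (ν-stair a 1≤a a≤n)
        (trans (cong (drop (r ∸ a)) μ≡complement) (sym (νλ≡complement-stair n r s k a)))

    module FromRectangle (in-rect : InRect n r s k) (k-last : k n ≡ 0) where
      open Complement n r s k

      μ : List ℕ
      μ = complement n r s k

      open Stair n r 1≤r r<n μ complement-length
      open StairSum id refl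

      Δ : ℕ → ℕ
      Δ a = largest (stair a)

      νλ≡stair : ∀ a → νλ n r s k a ≡ stair a
      νλ≡stair = νλ≡complement-stair n r s k

      row≤s : ∀ a → 1 ≤ a → row n k a ≤ s
      row≤s a 1≤a = ℕ.≤-trans (row-antitone n k 1≤a) (proj₁ in-rect)

      row-r : row n k r ≡ k r
      row-r = trans (row-suc n k r r<n) (trans (cong (k r ℕ.+_) (proj₂ in-rect)) (ℕ.+-identityʳ (k r)))

      k-above : ∀ b → r < b → b ≤ n → k b ≡ 0
      k-above b r<b b≤n with ℕ.m≤n⇒m<n∨m≡n b≤n
      ... | inj₁ b<n  = row≡0⇒k≡0 n k (suc r) b (proj₂ in-rect) r<b b<n
      ... | inj₂ refl = k-last

      Δ-rise : ∀ b → 1 ≤ b → b < r → Δ b ℕ.+ k b ≡ Δ (suc b)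
      Δ-rise b 1≤b b<r = begin
        Δ b ℕ.+ k b                                ≡⟨ cong (ℕ._+ k b) (complement-entry b 1≤b (ℕ.<⇒≤ b<r)) ⟩
        s ∸ row n k b ℕ.+ k b                      ≡⟨ cong (λ m → s ∸ m ℕ.+ k b) (row-suc n k b b<n) ⟩
        s ∸ (k b ℕ.+ row n k (suc b)) ℕ.+ k b      ≡⟨ cong (λ m → s ∸ m ℕ.+ k b) (ℕ.+-comm (k b) _) ⟩
        s ∸ (row n k (suc b) ℕ.+ k b) ℕ.+ k b      ≡⟨ cong (ℕ._+ k b) (sym (ℕ.∸-+-assoc s (row n k (suc b)) (k b))) ⟩
        s ∸ row n k (suc b) ∸ k b ℕ.+ k b          ≡⟨ ℕ.m∸n+n≡m kb≤ ⟩
        s ∸ row n k (suc b)                        ≡⟨ sym (complement-entry (suc b) (s≤s z≤n) b<r) ⟩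
        Δ (suc b)                                  ∎
        where
        open ≡-Reasoning
        b<n : b < n
        b<n = ℕ.<-trans b<r r<n
        kb≤ : k b ≤ s ∸ row n k (suc b)
        kb≤ = ℕ.m+n≤o⇒m≤o∸n (k b) (subst (_≤ s) (row-suc n k b b<n) (row≤s b 1≤b))

      Δ-top : Δ r ℕ.+ k r ≡ s
      Δ-top = begin
        Δ r ℕ.+ k r          ≡⟨ cong (ℕ._+ k r) (complement-entry r 1≤r ℕ.≤-refl) ⟩
        s ∸ row n k r ℕ.+ k r ≡⟨ cong (λ m → s ∸ m ℕ.+ k r) row-r ⟩
        s ∸ k r ℕ.+ k r      ≡⟨ ℕ.m∸n+n≡m (subst (_≤ s) row-r (row≤s r 1≤r)) ⟩
        s                    ∎
        where open ≡-Reasoning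

      configuration-stair : ∀ b → 1 ≤ b → b ≤ n → cartanSum n b (λ a → + sumℕ (map id (stair a))) ≡ + Lsize L b - + k b
      configuration-stair b 1≤b b≤n with ℕ.<-cmp b r
      ... | tri< b<r _ _ = begin
        cartanSum n b _        ≡⟨ cartanSum-below b 1≤b b<r ⟩
        + Δ b - + Δ (suc b)    ≡⟨ proj₂ (x-y≡-z⇔x+z≡y (Δ b) (Δ (suc b)) (k b)) (Δ-rise b 1≤b b<r) ⟩
        + 0 - + k b            ≡⟨ cong (λ m → + m - + k b) (sym (Lsize-off b (ℕ.<⇒≢ b<r))) ⟩
        + Lsize L b - + k b    ∎
        where open ≡-Reasoning
      ... | tri≈ _ refl _ = begin
        cartanSum n b _        ≡⟨ cartanSum-at ⟩
        + Δ b                  ≡⟨ proj₂ (x≡y-z⇔x+z≡y (Δ b) s (k b)) Δ-top ⟩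
        + s - + k b            ≡⟨ cong (λ m → + m - + k b) (sym Lsize-at) ⟩
        + Lsize L b - + k b    ∎
        where open ≡-Reasoning
      ... | tri> _ _ r<b = begin
        cartanSum n b _        ≡⟨ cartanSum-above b r<b b≤n ⟩
        + 0 - + 0              ≡⟨ cong₂ (λ u v → + u - + v) (sym (Lsize-off b (ℕ.>⇒≢ r<b))) (sym (k-above b r<b b≤n)) ⟩
        + Lsize L b - + k b    ∎
        where open ≡-Reasoning

      largest≤s : largest μ ≤ s
      largest≤s = subst (_≤ s) (trans (sym (complement-entry r 1≤r ℕ.≤-refl)) (cong (λ m → largest (drop m μ)) (ℕ.n∸n≡0 r)))
                        (ℕ.m∸n≤m s (row n k r))

      open StairVacancy s (proj₁ complement-partition) largest≤s

      vac-stair : ∀ {ν} → (∀ a → 1 ≤ a → a ≤ n → ν a ≡ stair a) → ∀ a i → vac n L ν a i ≡ ℤ→ℚ (vacancy n L stair a i)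
      vac-stair {ν} ν≡stair a i = trans (vac≡vacancy n L ν a i) (cong ℤ→ℚ (cong (ℤ._-_ (+ Lmin L a i))
        (cartanSum-cong n a _ _ (λ b 1≤b b≤n → cong (λ μ → + Q i μ) (ν≡stair b 1≤b b≤n)))))

      vac-νλ-nonneg : ∀ a i → 1 ≤ a → a ≤ n → 0ℚ ℚ.≤ vac n L (νλ n r s k) a i
      vac-νλ-nonneg a i 1≤a a≤n =
        subst (0ℚ ℚ.≤_) (sym (vac-stair (λ b _ _ → νλ≡stair b) a i)) (ℤ→ℚ-mono-≤ (stair-vacancy-nonneg a i 1≤a a≤n))

      exists : hwRC n L k (νλ n r s k) (λ a → zeroLabels (νλ n r s k a))
      exists = (λ a _ _ → subst IsPartition (sym (νλ≡stair a)) (IsPartition-drop (r ∸ a) complement-partition))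
             , (λ b 1≤b b≤n → trans (cartanSum-cong n b _ _ (λ a _ _ → cong (λ ν → + sumℕ ν) (trans (νλ≡stair a) (sym (map-id (stair a))))))
                                    (configuration-stair b 1≤b b≤n))
             , (λ a i 1≤a a≤n _ → vac-νλ-nonneg a i 1≤a a≤n)
             , (λ a 1≤a a≤n → zeroLabels-fit (νλ n r s k a) (vac n L (νλ n r s k) a) (λ j → vac-νλ-nonneg a j 1≤a a≤n))

      labels-vanish : ∀ {ν J} → hwRC n L k ν J → (∀ a → 1 ≤ a → a ≤ n → ν a ≡ νλ n r s k a) →
        ∀ a → 1 ≤ a → a ≤ n → J a ≡ zeroLabels (νλ n r s k a)
      labels-vanish {ν} rc ν≡νλ a 1≤a a≤n =
        trans (labels-under-zero (vac n L ν a) (proj₂ (proj₂ (proj₂ rc)) a 1≤a a≤n) vanish) (cong zeroLabels (ν≡νλ a 1≤a a≤n))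
        where
        ν≡stair : ∀ b → 1 ≤ b → b ≤ n → ν b ≡ stair b
        ν≡stair b 1≤b b≤n = trans (ν≡νλ b 1≤b b≤n) (νλ≡stair b)
        vanish : All (λ j → vac n L ν a j ≡ 0ℚ) (ν a)
        vanish = subst (All _) (sym (ν≡stair a 1≤a a≤n))
          (All.map (λ {j} j≤ → trans (vac-stair ν≡stair a j) (cong ℤ→ℚ (stair-vacancy-zero a j 1≤a a≤n j≤)))
                   (All≤largest (Decreasing-drop (r ∸ a) (proj₁ complement-partition))))

open HighestWeight

lemma4p16 : (n r s : ℕ) (k : ℕ → ℕ) → 1 ≤ r → r < n → 1 ≤ s → k n ≡ 0 →
    ((∃₂ λ ν J → hwRC n ((r , s) ∷ []) k ν J) → InRect n r s k) ×
    (InRect n r s k →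
      hwRC n ((r , s) ∷ []) k (νλ n r s k) (λ a → zeroLabels (νλ n r s k a)) ×
      (∀ ν J → hwRC n ((r , s) ∷ []) k ν J →
        ∀ a → 1 ≤ a → a ≤ n → (ν a ≡ νλ n r s k a) × (J a ≡ zeroLabels (νλ n r s k a))))
lemma4p16 n r s k 1≤r r<n _ k-last =
    (λ (_ , _ , rc) → in-rect rc)
  , λ rect → exists rect k-last
           , λ ν J rc a 1≤a a≤n → ν≡νλ rc a 1≤a a≤n , labels-vanish rect k-last rc (ν≡νλ rc) a 1≤a a≤n
  where
  open FromRiggedConfiguration n r s k 1≤r r<n using (in-rect; ν≡νλ)
  open FromRectangle n r s k 1≤r r<n using (exists; labels-vanish)
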